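{- Let $M(\cdot)$ be the function from the context. For any $d,\beta,\varepsilon>0$ with $\varepsilon\le d^2/100$ there exist $k_0$ and $\gamma>0$ such that the following holds. Let $T$ be a tree on $k\ge k_0$ vertices with colour classes $V_1,V_2$ such that $\deg_T(v)\le \gamma k$ for all $v\in V_2$, and let $(W,\mathcal D)$, $\mathcal D=\mathcal D'\sqcup\mathcal D''$, be a one-sided $\beta k$-fine partition of $T$ (with respect to $V_1,V_2$). Let $G$ be a graph and $\mathbf v_1,\mathbf v_2\subseteq V(G)$ disjoint vertex sets forming an $\varepsilon$-regular pair of density at least $d$, with $|\mathbf v_1|=|\mathbf v_2|\ge k/M(\varepsilon)$. Let $U\subseteq \mathbf v_1$ with $|U|\le 2\sqrt{\varepsilon}|\mathbf v_1|$. Then there is an injective map $\phi: W\cup\bigcup_{K\in\mathcal D''}V(K)\to V(G)$ with $\phi(W)\subseteq \mathbf v_1\setminus U$ and $\phi(\bigcup_{K\in\mathcal D''}V(K))\subseteq\mathbf v_2$ which is an embedding, i.e. any two vertices of this domain adjacent in $T$ are mapped to adjacent vertices of $G$.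
   Context: $M(\varepsilon)$ denotes the (fixed, depending only on $\varepsilon$) upper bound $M$ on the number of clusters supplied by Szemerédi's regularity lemma for parameter $\varepsilon$: for every $\varepsilon>0$ there are $n_0,M$ such that every graph on at least $n_0$ vertices has an $\varepsilon$-regular equitable partition into a garbage set and $m$ clusters with $1/\varepsilon\le m\le M$. For disjoint $X,Y\subseteq V(G)$, the density is $d(X,Y)=e(X,Y)/(|X||Y|)$, and $(X,Y)$ is an $\varepsilon$-regular pair if $|d(X',Y')-d(X,Y)|\le\varepsilon$ for all $X'\subseteq X$, $Y'\subseteq Y$ with $|X'|\ge\varepsilon|X|$, $|Y'|\ge\varepsilon|Y|$. For a tree $T$ on $k'+1$ vertices with colour classes $V_1,V_2$ and $\Delta=\max_{v\in V_2}\deg_T(v)$, a one-sided $\ell$-fine partition is a pair $(W,\mathcal D)$ with $W\subseteq V_1$ and $\mathcal D$ a family of subtrees of $T$ such that: (1) $W$ and the $V(K)$, $K\in\mathcal D$, partition $V(T)$; (2) $|W|\le 336k'(1+\Delta)/\ell$; (3) $|V(K)|\le\ell$ for each $K\in\mathcal D$; (4) $N_T(V(K))\setminus V(K)\subseteq W$ for each $K\in\mathcal D$; (5) $\mathcal D=\mathcal D'\sqcup\mathcal D''$ where each tree of $\mathcal D'$ has at most two neighbours in $W$, at distance at least $4$ in $T$ if there are two, while $|\mathcal D''|\le 336k'/\ell$ and each tree of $\mathcal D''$ is a single vertex with at most $\Delta$ neighbours in $W$.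
   Formalization: The parameters d, β and ε range over the positive rationals. -}

module Defs where

open import Data.Nat as ℕ using (ℕ; zero; suc; _⊔_)
open import Data.Integer using (+_)
open import Data.Rational using (ℚ; 0ℚ; _/_; _≤_; _*_; _-_; ∣_∣)
open import Data.Bool using (Bool; true; false; if_then_else_; _∧_; _∨_; not)
open import Data.Fin using (Fin; zero; suc; inject₁; fromℕ)
open import Data.Fin.Properties using () renaming (_≟_ to _≟F_)
open import Data.Maybe using (Maybe; nothing; just)
open import Data.Product using (∃; Σ; _×_; _,_)
open import Data.Empty using (⊥)
open import Relation.Nullary using (¬_; does)
open import Relation.Binary.PropositionalEquality using (_≡_; _≢_)

⟦_⟧ : ℕ → ℚ
⟦ n ⟧ = + n / 1

VSet : ℕ → Set
VSet n = Fin n → Bool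

count : ∀ {n} → (Fin n → Bool) → ℕ
count {zero} P = 0
count {suc n} P = (if P zero then 1 else 0) ℕ.+ count (λ i → P (suc i))

sumF : ∀ {n} → (Fin n → ℕ) → ℕ
sumF {zero} f = 0
sumF {suc n} f = f zero ℕ.+ sumF (λ i → f (suc i))

anyF : ∀ {n} → (Fin n → Bool) → Bool
anyF {zero} P = false
anyF {suc n} P = P zero ∨ anyF (λ i → P (suc i))

-- maximum of f over the elements in S (0 if S empty)
maxOver : ∀ {n} → (Fin n → Bool) → (Fin n → ℕ) → ℕ
maxOver {zero} S f = 0
maxOver {suc n} S f =
  (if S zero then f zero else 0) ⊔ maxOver (λ i → S (suc i)) (λ i → f (suc i))

_⊆_ : ∀ {n} → VSet n → VSet n → Set
X ⊆ Y = ∀ v → X v ≡ true → Y v ≡ true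

Disjoint : ∀ {n} → VSet n → VSet n → Set
Disjoint X Y = ∀ v → X v ≡ true → Y v ≡ false

record Graph (n : ℕ) : Set where
  field
    adj    : Fin n → Fin n → Bool
    sym    : ∀ u v → adj u v ≡ adj v u
    irrefl : ∀ v → adj v v ≡ false
open Graph public

Adj : ∀ {n} → Graph n → Fin n → Fin n → Set
Adj G u v = adj G u v ≡ true

deg : ∀ {n} → Graph n → Fin n → ℕ
deg G v = count (adj G v)

data Walk {n} (G : Graph n) : Fin n → Fin n → ℕ → Set where
  here : ∀ {u} → Walk G u u 0
  step : ∀ {u w v m} → Adj G u w → Walk G w v m → Walk G u v (suc m)

data WalkIn {n} (G : Graph n) (S : VSet n) : Fin n → Fin n → Set where
  here : ∀ {u} → S u ≡ true → WalkIn G S u u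
  step : ∀ {u w v} → S u ≡ true → Adj G u w → WalkIn G S w v → WalkIn G S u v

Connected : ∀ {n} → Graph n → Set
Connected G = ∀ u v → ∃ λ m → Walk G u v m

ConnectedIn : ∀ {n} → Graph n → VSet n → Set
ConnectedIn G S = ∀ u v → S u ≡ true → S v ≡ true → WalkIn G S u v

-- a cycle of length m+3: distinct vertices c_0,…,c_{m+2}, consecutive ones adjacent
record Cycle {n} (G : Graph n) : Set where
  field
    len   : ℕ
    c     : Fin (suc (suc (suc len))) → Fin n
    inj   : ∀ i j → c i ≡ c j → i ≡ j
    edges : ∀ (i : Fin (suc (suc len))) → Adj G (c (inject₁ i)) (c (suc i))
    close : Adj G (c (fromℕ (suc (suc len)))) (c zero)

IsTree : ∀ {n} → Graph n → Set
IsTree G = Connected G × ¬ Cycle G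

-- proper 2-colouring; V₁ = colour false, V₂ = colour true
ProperColouring : ∀ {n} → Graph n → (Fin n → Bool) → Set
ProperColouring G col = ∀ u v → Adj G u v → col u ≢ col v

DistGe4 : ∀ {n} → Graph n → Fin n → Fin n → Set
DistGe4 G u v = ∀ m → Walk G u v m → 4 ℕ.≤ m

Δ₂ : ∀ {n} → Graph n → (Fin n → Bool) → ℕ
Δ₂ T col = maxOver col (deg T)

-- One-sided ℓ-fine partition (W, 𝒟 = 𝒟' ⊔ 𝒟'') of a tree T on k = k'+1 vertices.
-- Encoded by part : V(T) → Maybe (Fin p): nothing = in W, just i = in the i-th tree K_i of 𝒟;
-- dd i = true iff K_i ∈ 𝒟''.
module _ {k p : ℕ} (part : Fin k → Maybe (Fin p)) where

  inW : VSet k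
  inW v with part v
  ... | nothing = true
  ... | just _  = false

  inK : Fin p → VSet k
  inK i v with part v
  ... | nothing = false
  ... | just j  = does (j ≟F i)

module _ {k : ℕ} (T : Graph k) (col : Fin k → Bool) {p : ℕ}
         (part : Fin k → Maybe (Fin p)) where

  nbW : Fin p → VSet k
  nbW i w = inW part w ∧ anyF (λ u → inK part i u ∧ adj T u w)

  record OneSidedFine (ℓ : ℚ) (dd : Fin p → Bool) : Set where
    k' = k ℕ.∸ 1
    Δ  = Δ₂ T col
    field
      W⊆V₁       : ∀ v → inW part v ≡ true → col v ≡ false
      K-nonempty : ∀ i → ∃ λ v → inK part i v ≡ true
      K-subtree  : ∀ i → ConnectedIn T (inK part i)
      -- (2) |W| ≤ 336 k'(1+Δ)/ℓ, written with ℓ multiplied out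
      W-size     : ⟦ count (inW part) ⟧ * ℓ ≤ ⟦ 336 ℕ.* k' ℕ.* (1 ℕ.+ Δ) ⟧
      K-size     : ∀ i → ⟦ count (inK part i) ⟧ ≤ ℓ
      K-nbhd     : ∀ i u w → inK part i u ≡ true → Adj T u w → inK part i w ≡ false → inW part w ≡ true
      D'-nb      : ∀ i → dd i ≡ false → count (nbW i) ℕ.≤ 2
      D'-far     : ∀ i → dd i ≡ false → ∀ w₁ w₂ → nbW i w₁ ≡ true → nbW i w₂ ≡ true →
                   w₁ ≢ w₂ → DistGe4 T w₁ w₂
      D''-count  : ⟦ count dd ⟧ * ℓ ≤ ⟦ 336 ℕ.* k' ⟧
      D''-single : ∀ i → dd i ≡ true → count (inK part i) ≡ 1
      D''-nb     : ∀ i → dd i ≡ true → count (nbW i) ℕ.≤ Δ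

eCount : ∀ {n} → Graph n → VSet n → VSet n → ℕ
eCount G X Y = sumF (λ x → if X x then count (λ y → Y y ∧ adj G x y) else 0)

-- d(X,Y) = e(X,Y)/(|X||Y|)  (set to 0 when X or Y is empty)
density : ∀ {n} → Graph n → VSet n → VSet n → ℚ
density G X Y with count X ℕ.* count Y
... | zero  = 0ℚ
... | suc m = + eCount G X Y / suc m

RegularPair : ∀ {n} → Graph n → ℚ → VSet n → VSet n → Set
RegularPair G ε X Y =
  ∀ X' Y' → X' ⊆ X → Y' ⊆ Y →
  ε * ⟦ count X ⟧ ≤ ⟦ count X' ⟧ → ε * ⟦ count Y ⟧ ≤ ⟦ count Y' ⟧ →
  ∣ density G X' Y' - density G X Y ∣ ≤ ε

inDom : ∀ {k p} → (Fin k → Maybe (Fin p)) → (Fin p → Bool) → VSet k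
inDom part dd v with part v
... | nothing = true
... | just i  = dd i

module Submission where

-- Let τ = d/2 and call a vertex of v₁ (of v₂) typical if it has at least τ|v₁| neighbours in v₂
-- (in v₁). Fewer than ε|v₁| vertices on either side are atypical, for otherwise they would form a
-- set whose density to the other side is below τ ≤ d - ε, contradicting regularity. The fine
-- partition bounds make |W| + |𝒟''| ≤ d|v₁|/4 once k₀ is large and γ small, and |U| ≤ d|v₁|/5.
-- Every edge of T inside the domain W ∪ ⋃𝒟'' joins W to a singleton of 𝒟'', and T is a forest
-- there, so the domain can be embedded greedily, each vertex after at most one of its neighbours:
-- W into typical vertices of v₁ ∖ U and 𝒟'' into typical vertices of v₂. The neighbourhood of a
-- typical image offers τ|v₁| candidates, while atypical, U- and already used vertices number less
-- than (d/20 + d/5 + d/4)|v₁| = τ|v₁|.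

open import Data.Nat as ℕ using (ℕ)
open import Data.Fin using (Fin)
open import Data.Bool using (Bool; true; false; not)
open import Data.Rational as ℚ using (ℚ)
import Data.Maybe
open import Data.Product using (∃; _×_)
open import Relation.Binary.PropositionalEquality using (_≡_)
open import Relation.Nullary using (¬_)
open import Defs using (Graph; VSet; Adj; Cycle; count; ⟦_⟧)

module Counting where

  open import Defs hiding (sym)
  open import Data.Nat using (ℕ; zero; suc; _+_; _*_; _≤_; _<_; z≤n; s≤s)
  open import Data.Nat.Properties hiding (_≟_)
  open import Data.Bool using (Bool; true; false; if_then_else_; _∧_; _∨_; not)
  open import Data.Bool using () renaming (_≟_ to _≟𝔹_)
  open import Data.Bool.Properties using (∨-zeroʳ; ∧-identityʳ; ∧-conicalˡ)
  open import Relation.Nullary.Decidable using (dec-true; dec-false; _×-dec_)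
  open import Data.Fin using (Fin; zero; suc)
  open import Data.Fin.Properties using (_≟_; any?)
  open import Data.Product using (∃; _×_; _,_)
  open import Data.Sum using (_⊎_; inj₁; inj₂)
  open import Data.Empty using (⊥-elim)
  open import Relation.Nullary using (does; yes; no)
  open import Relation.Binary.PropositionalEquality
  open import Algebra.Properties.CommutativeSemigroup +-commutativeSemigroup using (interchange)

  indicator : Bool → ℕ
  indicator b = if b then 1 else 0

  sumF-cong : ∀ {n} {f g : Fin n → ℕ} → (∀ i → f i ≡ g i) → sumF f ≡ sumF g
  sumF-cong {zero}  f≗g = refl
  sumF-cong {suc n} f≗g = cong₂ _+_ (f≗g zero) (sumF-cong (λ i → f≗g (suc i)))

  sumF-mono : ∀ {n} {f g : Fin n → ℕ} → (∀ i → f i ≤ g i) → sumF f ≤ sumF g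
  sumF-mono {zero}  f≤g = z≤n
  sumF-mono {suc n} f≤g = +-mono-≤ (f≤g zero) (sumF-mono (λ i → f≤g (suc i)))

  sumF-zero : ∀ n → sumF {n} (λ _ → 0) ≡ 0
  sumF-zero zero    = refl
  sumF-zero (suc n) = sumF-zero n

  sumF-+ : ∀ {n} (f g : Fin n → ℕ) → sumF (λ i → f i + g i) ≡ sumF f + sumF g
  sumF-+ {zero}  f g = refl
  sumF-+ {suc n} f g = trans (cong (f zero + g zero +_) (sumF-+ (λ i → f (suc i)) (λ i → g (suc i))))
                             (interchange (f zero) (g zero) _ _)

  sumF-swap : ∀ {a b} (f : Fin a → Fin b → ℕ) →
              sumF (λ i → sumF (f i)) ≡ sumF (λ j → sumF (λ i → f i j))
  sumF-swap {zero}  {b} f = sym (sumF-zero b)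
  sumF-swap {suc a} {b} f = begin
    sumF (f zero) + sumF (λ i → sumF (f (suc i)))
      ≡⟨ cong (sumF (f zero) +_) (sumF-swap (λ i → f (suc i))) ⟩
    sumF (f zero) + sumF (λ j → sumF (λ i → f (suc i) j))
      ≡⟨ sumF-+ (f zero) (λ j → sumF (λ i → f (suc i) j)) ⟨
    sumF (λ j → f zero j + sumF (λ i → f (suc i) j))
      ∎
    where open ≡-Reasoning

  count≡sumF : ∀ {n} (P : Fin n → Bool) → count P ≡ sumF (λ i → indicator (P i))
  count≡sumF {zero}  P = refl
  count≡sumF {suc n} P = cong (indicator (P zero) +_) (count≡sumF (λ i → P (suc i)))

  count-cong : ∀ {n} {P Q : Fin n → Bool} → (∀ i → P i ≡ Q i) → count P ≡ count Q
  count-cong {zero}  P≗Q = refl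
  count-cong {suc n} P≗Q = cong₂ _+_ (cong indicator (P≗Q zero)) (count-cong (λ i → P≗Q (suc i)))

  count-mono : ∀ {n} {P Q : VSet n} → P ⊆ Q → count P ≤ count Q
  count-mono {zero}                  P⊆Q = z≤n
  count-mono {suc n} {P} {Q}         P⊆Q = +-mono-≤ (indicator-mono (P⊆Q zero)) (count-mono (λ i → P⊆Q (suc i)))
    where
      indicator-mono : ∀ {a b} → (a ≡ true → b ≡ true) → indicator a ≤ indicator b
      indicator-mono {false} a⇒b = z≤n
      indicator-mono {true}  a⇒b rewrite a⇒b refl = ≤-refl

  count-∨ : ∀ {n} (P Q : Fin n → Bool) → count (λ i → P i ∨ Q i) ≤ count P + count Q
  count-∨ {zero}  P Q = z≤n
  count-∨ {suc n} P Q = ≤-trans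
    (+-mono-≤ (indicator-∨ (P zero) (Q zero)) (count-∨ (λ i → P (suc i)) (λ i → Q (suc i))))
    (≤-reflexive (interchange (indicator (P zero)) (indicator (Q zero)) _ _))
    where
      indicator-∨ : ∀ a b → indicator (a ∨ b) ≤ indicator a + indicator b
      indicator-∨ false b = ≤-refl
      indicator-∨ true  b = s≤s z≤n

  count-false : ∀ n → count {n} (λ _ → false) ≡ 0
  count-false zero    = refl
  count-false (suc n) = count-false n

  ∃⇒count>0 : ∀ {n} (P : Fin n → Bool) x → P x ≡ true → 1 ≤ count P
  ∃⇒count>0 P zero    Px rewrite Px = s≤s z≤n
  ∃⇒count>0 P (suc x) Px = ≤-trans (∃⇒count>0 (λ i → P (suc i)) x Px) (m≤n+m _ (indicator (P zero)))

  count>0⇒∃ : ∀ {n} (P : Fin n → Bool) → 1 ≤ count P → ∃ λ x → P x ≡ true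
  count>0⇒∃ {suc n} P 1≤count with P zero in P0
  ... | true  = zero , P0
  ... | false with count>0⇒∃ (λ i → P (suc i)) 1≤count
  ... | x , Px = suc x , Px

  ∃⇒anyF : ∀ {n} (P : Fin n → Bool) x → P x ≡ true → anyF P ≡ true
  ∃⇒anyF P zero    Px rewrite Px = refl
  ∃⇒anyF P (suc x) Px rewrite ∃⇒anyF (λ i → P (suc i)) x Px = ∨-zeroʳ (P zero)

  count-avoid : ∀ {n} (A B : Fin n → Bool) → count B < count A → ∃ λ y → A y ≡ true × B y ≡ false
  count-avoid A B B<A with any? (λ y → (A y ≟𝔹 true) ×-dec (B y ≟𝔹 false))
  ... | yes found = found
  ... | no  none  = ⊥-elim (<⇒≱ B<A (count-mono A⊆B))
    where
      A⊆B : A ⊆ B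
      A⊆B y Ay with B y in By
      ... | true  = refl
      ... | false = ⊥-elim (none (y , Ay , By))

  remove : ∀ {n} → VSet n → Fin n → VSet n
  remove S v u = S u ∧ not (does (u ≟ v))

  remove-⊆ : ∀ {n} (S : VSet n) v → remove S v ⊆ S
  remove-⊆ S v u = ∧-conicalˡ _ _

  remove-∈ : ∀ {n} (S : VSet n) v u → S u ≡ true → u ≢ v → remove S v u ≡ true
  remove-∈ S v u Su u≢v = cong₂ _∧_ Su (cong not (dec-false (u ≟ v) u≢v))

  count-remove : ∀ {n} (S : VSet n) v → S v ≡ true → count S ≡ suc (count (remove S v))
  count-remove {suc n} S zero    Sv rewrite Sv = cong suc (count-cong (λ i → sym (∧-identityʳ (S (suc i)))))
  count-remove {suc n} S (suc v) Sv = begin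
    indicator (S zero) + count (λ i → S (suc i))
      ≡⟨ cong (indicator (S zero) +_) (count-remove (λ i → S (suc i)) v Sv) ⟩
    indicator (S zero) + suc (count (remove (λ i → S (suc i)) v))
      ≡⟨ +-suc (indicator (S zero)) _ ⟩
    suc (indicator (S zero) + count (remove (λ i → S (suc i)) v))
      ≡⟨ cong (λ b → suc (indicator b + count (remove (λ i → S (suc i)) v))) (∧-identityʳ (S zero)) ⟨
    suc (count (remove S (suc v)))
      ∎
    where open ≡-Reasoning

  distinct⇒2≤count : ∀ {n} (P : VSet n) u v → P u ≡ true → P v ≡ true → u ≢ v → 2 ≤ count P
  distinct⇒2≤count P u v Pu Pv u≢v rewrite count-remove P u Pu =
    s≤s (∃⇒count>0 (remove P u) v (remove-∈ P u v Pv (λ v≡u → u≢v (sym v≡u))))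

  count-singleton : ∀ {n} (c : Fin n) → count (λ y → does (c ≟ y)) ≡ 1
  count-singleton {suc n} zero    = cong suc (count-false n)
  count-singleton {suc n} (suc c) = count-singleton c

  image : ∀ {k n} → (Fin k → Fin n) → VSet k → VSet n
  image φ S y = anyF (λ w → S w ∧ does (φ w ≟ y))

  image-∋ : ∀ {k n} (φ : Fin k → Fin n) (S : VSet k) w → S w ≡ true → image φ S (φ w) ≡ true
  image-∋ φ S w Sw = ∃⇒anyF _ w (cong₂ _∧_ Sw (dec-true (φ w ≟ φ w) refl))

  count-image : ∀ {k n} (φ : Fin k → Fin n) (S : VSet k) → count (image φ S) ≤ count S
  count-image {zero}  {n} φ S = ≤-reflexive (count-false n)
  count-image {suc k} {n} φ S = ≤-trans
    (count-∨ (λ y → S zero ∧ does (φ zero ≟ y)) (image (λ i → φ (suc i)) (λ i → S (suc i))))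
    (+-mono-≤ (first (S zero)) (count-image (λ i → φ (suc i)) (λ i → S (suc i))))
    where
      first : ∀ b → count (λ y → b ∧ does (φ zero ≟ y)) ≤ indicator b
      first false = ≤-reflexive (count-false n)
      first true  = ≤-reflexive (count-singleton (φ zero))

  eCount≡sumF : ∀ {n} (G : Graph n) X Y →
                eCount G X Y ≡ sumF (λ x → sumF (λ y → indicator (X x ∧ (Y y ∧ adj G x y))))
  eCount≡sumF {n} G X Y = sumF-cong row
    where
      row : ∀ x → (if X x then count (λ y → Y y ∧ adj G x y) else 0) ≡
                  sumF (λ y → indicator (X x ∧ (Y y ∧ adj G x y)))
      row x with X x
      ... | true  = count≡sumF (λ y → Y y ∧ adj G x y)
      ... | false = sym (sumF-zero n)

  eCount-sym : ∀ {n} (G : Graph n) X Y → eCount G X Y ≡ eCount G Y X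
  eCount-sym G X Y = begin
    eCount G X Y
      ≡⟨ eCount≡sumF G X Y ⟩
    sumF (λ x → sumF (λ y → indicator (X x ∧ (Y y ∧ adj G x y))))
      ≡⟨ sumF-swap (λ x y → indicator (X x ∧ (Y y ∧ adj G x y))) ⟩
    sumF (λ y → sumF (λ x → indicator (X x ∧ (Y y ∧ adj G x y))))
      ≡⟨ sumF-cong (λ y → sumF-cong (λ x → cong indicator (flip (X x) (Y y) (Graph.sym G x y)))) ⟩
    sumF (λ y → sumF (λ x → indicator (Y y ∧ (X x ∧ adj G y x))))
      ≡⟨ eCount≡sumF G Y X ⟨
    eCount G Y X
      ∎
    where
      open ≡-Reasoning
      flip : ∀ a b {c c′} → c ≡ c′ → a ∧ (b ∧ c) ≡ b ∧ (a ∧ c′)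
      flip false false _    = refl
      flip false true  _    = refl
      flip true  false _    = refl
      flip true  true  c≡c′ = c≡c′

  eCount≤ : ∀ {n} (G : Graph n) X Y → eCount G X Y ≤ count X * count Y
  eCount≤ {n} G X Y = ≤-trans (sumF-mono row) (≤-reflexive (rows (count Y) X))
    where
      row : ∀ x → (if X x then count (λ y → Y y ∧ adj G x y) else 0) ≤ (if X x then count Y else 0)
      row x with X x
      ... | true  = count-mono {Q = Y} (λ y → ∧-conicalˡ _ _)
      ... | false = z≤n
      rows : ∀ {n} c (X : Fin n → Bool) → sumF (λ x → if X x then c else 0) ≡ count X * c
      rows {zero}  c X = refl
      rows {suc n} c X with X zero
      ... | true  = cong (c +_) (rows c (λ i → X (suc i)))
      ... | false = rows c (λ i → X (suc i))

  maxOver-attained : ∀ {n} (S : Fin n → Bool) (f : Fin n → ℕ) →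
                     maxOver S f ≡ 0 ⊎ ∃ λ v → S v ≡ true × maxOver S f ≡ f v
  maxOver-attained {zero}  S f = inj₁ refl
  maxOver-attained {suc n} S f with ⊔-sel (if S zero then f zero else 0) (maxOver (λ i → S (suc i)) (λ i → f (suc i)))
  ... | inj₂ max≡rest with maxOver-attained (λ i → S (suc i)) (λ i → f (suc i))
  ...   | inj₁ rest≡0          = inj₁ (trans max≡rest rest≡0)
  ...   | inj₂ (v , Sv , rest≡) = inj₂ (suc v , Sv , trans max≡rest rest≡)
  maxOver-attained {suc n} S f | inj₁ max≡head with S zero in S₀
  ... | true  = inj₂ (zero , S₀ , max≡head)
  ... | false = inj₁ max≡head

module Forests {k : ℕ} (T : Graph k) where

  open Counting
  open import Defs hiding (sym; step)
  open import Data.Nat using (ℕ; zero; suc; _+_; _≤_; _<_; z≤n; s≤s) renaming (_≟_ to _≟ℕ_)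
  open import Data.Nat.Properties hiding (_≟_)
  open import Data.Bool using (true) renaming (_≟_ to _≟𝔹_)
  open import Data.Fin using (Fin; zero; suc; toℕ; fromℕ; fromℕ<; inject₁)
  open import Data.Fin.Properties using (_≟_; any?; toℕ-injective; toℕ<n; toℕ≤pred[n]; toℕ-fromℕ<;
                                         toℕ-inject₁; toℕ-fromℕ; injective⇒≤)
  open import Data.Product using (∃; _×_; _,_)
  open import Data.Sum using (_⊎_; inj₁; inj₂)
  open import Data.Empty using (⊥-elim)
  open import Relation.Nullary using (Dec; yes; no; ¬_)
  open import Relation.Nullary.Decidable using (¬?; _×-dec_)
  open import Relation.Binary.PropositionalEquality

  adj⇒≢ : ∀ {u v} → Adj T u v → u ≢ v
  adj⇒≢ {u} u~u refl with () ← trans (sym u~u) (Graph.irrefl T u)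

  record PathIn (S : VSet k) (l : ℕ) : Set where
    field
      vertex   : ℕ → Fin k
      inside   : ∀ a → a ≤ l → S (vertex a) ≡ true
      distinct : ∀ a b → a ≤ l → b ≤ l → vertex a ≡ vertex b → a ≡ b
      step     : ∀ a → a < l → Adj T (vertex a) (vertex (suc a))

  open PathIn

  trivial-path : ∀ {S} s → S s ≡ true → PathIn S 0
  trivial-path s Ss = record
    { vertex   = λ _ → s
    ; inside   = λ _ _ → Ss
    ; distinct = λ a b a≤0 b≤0 _ → trans (n≤0⇒n≡0 a≤0) (sym (n≤0⇒n≡0 b≤0))
    ; step     = λ _ ()
    }

  path-length : ∀ {S l} → PathIn S l → suc l ≤ k
  path-length P = injective⇒≤ (λ e → toℕ-injective (distinct P _ _ (toℕ≤pred[n] _) (toℕ≤pred[n] _) e))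

  prepend : ∀ {S l} (P : PathIn S l) w → S w ≡ true → Adj T w (vertex P 0) →
            (∀ a → a ≤ l → vertex P a ≢ w) → PathIn S (suc l)
  prepend {S} {l} P w Sw w~P₀ fresh = record
    { vertex = vertex′ ; inside = inside′ ; distinct = distinct′ ; step = step′ }
    where
      vertex′ : ℕ → Fin k
      vertex′ zero    = w
      vertex′ (suc a) = vertex P a
      inside′ : ∀ a → a ≤ suc l → S (vertex′ a) ≡ true
      inside′ zero    _         = Sw
      inside′ (suc a) (s≤s a≤l) = inside P a a≤l
      distinct′ : ∀ a b → a ≤ suc l → b ≤ suc l → vertex′ a ≡ vertex′ b → a ≡ b
      distinct′ zero    zero    _         _         _ = refl
      distinct′ zero    (suc b) _         (s≤s b≤l) e = ⊥-elim (fresh b b≤l (sym e))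
      distinct′ (suc a) zero    (s≤s a≤l) _         e = ⊥-elim (fresh a a≤l e)
      distinct′ (suc a) (suc b) (s≤s a≤l) (s≤s b≤l) e = cong suc (distinct P a b a≤l b≤l e)
      step′ : ∀ a → a < suc l → Adj T (vertex′ a) (vertex′ (suc a))
      step′ zero    _         = w~P₀
      step′ (suc a) (s≤s a<l) = step P a a<l

  on-path? : ∀ {S l} (P : PathIn S l) w → Dec (∃ λ (t : Fin (suc l)) → vertex P (toℕ t) ≡ w)
  on-path? P w = any? (λ t → vertex P (toℕ t) ≟ w)

  record MaximalPathIn (S : VSet k) : Set where
    field
      length  : ℕ
      path    : PathIn S length
      maximal : ∀ w → S w ≡ true → Adj T (vertex path 0) w → ∃ λ a → a ≤ length × vertex path a ≡ w

  extend-maximally : ∀ {S l} fuel → PathIn S l → k ≤ fuel + l → MaximalPathIn S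
  extend-maximally zero P k≤l = ⊥-elim (<⇒≱ (path-length P) k≤l)
  extend-maximally {S} {l} (suc fuel) P k≤
    with any? (λ w → (S w ≟𝔹 true) ×-dec (adj T (vertex P 0) w ≟𝔹 true) ×-dec ¬? (on-path? P w))
  ... | yes (w , Sw , P₀~w , off) = extend-maximally fuel (prepend P w Sw (trans (Graph.sym T w _) P₀~w) fresh)
                                                   (subst (k ≤_) (sym (+-suc fuel l)) k≤)
    where
      fresh : ∀ a → a ≤ l → vertex P a ≢ w
      fresh a a≤l e = off (fromℕ< (s≤s a≤l) , trans (cong (vertex P) (toℕ-fromℕ< (s≤s a≤l))) e)
  ... | no none = record { length = l ; path = P ; maximal = maximal }
    where
      maximal : ∀ w → S w ≡ true → Adj T (vertex P 0) w → ∃ λ a → a ≤ l × vertex P a ≡ w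
      maximal w Sw P₀~w with on-path? P w
      ... | yes (t , e) = toℕ t , toℕ≤pred[n] t , e
      ... | no  off     = ⊥-elim (none (w , Sw , P₀~w , off))

  closing-cycle : ∀ {S l} (P : PathIn S l) i → 2 ≤ i → i ≤ l → Adj T (vertex P i) (vertex P 0) → Cycle T
  closing-cycle P (suc (suc len)) (s≤s (s≤s z≤n)) i≤l closes = record
    { len = len ; c = c ; inj = inj ; edges = edges ; close = close }
    where
      c : Fin (suc (suc (suc len))) → Fin k
      c t = vertex P (toℕ t)
      inj : ∀ a b → c a ≡ c b → a ≡ b
      inj a b e = toℕ-injective (distinct P _ _ (≤-trans (toℕ≤pred[n] a) i≤l) (≤-trans (toℕ≤pred[n] b) i≤l) e)
      edges : ∀ t → Adj T (c (inject₁ t)) (c (suc t))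
      edges t = subst (λ a → Adj T (vertex P a) (vertex P (suc (toℕ t)))) (sym (toℕ-inject₁ t))
                      (step P (toℕ t) (<-≤-trans (toℕ<n t) i≤l))
      close : Adj T (c (fromℕ (suc (suc len)))) (c zero)
      close = subst (λ a → Adj T (vertex P a) (vertex P 0)) (sym (toℕ-fromℕ _)) closes

  far-position : ∀ {a b} → 1 ≤ a → 1 ≤ b → a ≢ b → 2 ≤ a ⊎ 2 ≤ b
  far-position {suc (suc _)} _         _         _   = inj₁ (s≤s (s≤s z≤n))
  far-position {suc zero}    {suc (suc _)} _ _   _   = inj₂ (s≤s (s≤s z≤n))
  far-position {suc zero}    {suc zero}    _ _ a≢b = ⊥-elim (a≢b refl)

  -- The start of a maximal path in S has no S-neighbour off the path, and a second one on the
  -- path would close a cycle.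
  forest-leaf : ¬ Cycle T → ∀ S → 1 ≤ count S →
                ∃ λ v → S v ≡ true × (∀ u u′ → S u ≡ true → S u′ ≡ true → Adj T v u → Adj T v u′ → u ≡ u′)
  forest-leaf acyclic S 1≤|S| with count>0⇒∃ S 1≤|S|
  ... | s , Ss = vertex path 0 , inside path 0 z≤n , unique
    where
      open MaximalPathIn (extend-maximally k (trivial-path {S} s Ss) (≤-reflexive (sym (+-identityʳ k))))
      off-start : ∀ a → Adj T (vertex path 0) (vertex path a) → 1 ≤ a
      off-start zero    loop = ⊥-elim (adj⇒≢ loop refl)
      off-start (suc a) _    = s≤s z≤n
      cycle-at : ∀ a → 2 ≤ a → a ≤ length → Adj T (vertex path 0) (vertex path a) → Cycle T
      cycle-at a 2≤a a≤l P₀~Pₐ = closing-cycle path a 2≤a a≤l (trans (Graph.sym T _ _) P₀~Pₐ)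
      unique : ∀ u u′ → S u ≡ true → S u′ ≡ true → Adj T (vertex path 0) u → Adj T (vertex path 0) u′ → u ≡ u′
      unique u u′ Su Su′ v~u v~u′ with maximal u Su v~u | maximal u′ Su′ v~u′
      ... | a , a≤l , refl | b , b≤l , refl with a ≟ℕ b
      ...   | yes refl = refl
      ...   | no a≢b with far-position (off-start a v~u) (off-start b v~u′) a≢b
      ...     | inj₁ 2≤a = ⊥-elim (acyclic (cycle-at a 2≤a a≤l v~u))
      ...     | inj₂ 2≤b = ⊥-elim (acyclic (cycle-at b 2≤b b≤l v~u′))

module GreedyEmbedding {k n : ℕ} (T : Graph k) (acyclic : ¬ Cycle T) (G : Graph n) (junk : Fin n)
  (Dom : VSet k) (Ok : Fin k → Fin n → Set)
  (place : ∀ v (Used : VSet n) → Dom v ≡ true → count Used ℕ.< count Dom →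
           ∃ λ y → Ok v y × Used y ≡ false)
  (place-beside : ∀ u v x (Used : VSet n) → Dom u ≡ true → Dom v ≡ true → Adj T u v → Ok u x →
                  count Used ℕ.< count Dom → ∃ λ y → Adj G x y × Ok v y × Used y ≡ false)
  where

  open Counting
  open Forests T using (forest-leaf; adj⇒≢)
  open import Defs hiding (sym)
  open import Data.Nat using (zero; suc; _≤_; _<_; z≤n; s≤s)
  open import Data.Nat.Properties using (≤-reflexive; <-≤-trans; ≤-<-trans; suc-injective)
  open import Data.Bool using () renaming (_≟_ to _≟𝔹_)
  open import Data.Fin.Properties using (_≟_; any?)
  open import Data.Vec.Functional using (updateAt)
  open import Data.Vec.Functional.Properties using (updateAt-updates; updateAt-minimal)
  open import Data.Product using (Σ; _,_)
  open import Data.Sum using (_⊎_; inj₁; inj₂)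
  open import Data.Empty using (⊥-elim)
  open import Relation.Nullary using (yes; no)
  open import Relation.Nullary.Decidable using (_×-dec_)
  open import Relation.Binary.PropositionalEquality hiding ([_])

  record Embeds (S : VSet k) (φ : Fin k → Fin n) : Set where
    field
      injective   : ∀ a b → S a ≡ true → S b ≡ true → φ a ≡ φ b → a ≡ b
      admissible  : ∀ a → S a ≡ true → Ok a (φ a)
      homomorphic : ∀ a b → S a ≡ true → S b ≡ true → Adj T a b → Adj G (φ a) (φ b)

  open Embeds

  embeds-∅ : ∀ {S} φ → count S ≡ 0 → Embeds S φ
  embeds-∅ {S} φ |S|≡0 = record
    { injective   = λ a _ Sa → absurd a Sa
    ; admissible  = λ a Sa → absurd a Sa
    ; homomorphic = λ a _ Sa → absurd a Sa
    }
    where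
      absurd : ∀ {A : Set} a → S a ≡ true → A
      absurd a Sa with () ← subst (1 ≤_) |S|≡0 (∃⇒count>0 S a Sa)

  embeds-extend : ∀ {S φ} v y → S v ≡ true → Embeds (remove S v) φ → Ok v y →
                  image φ (remove S v) y ≡ false →
                  (∀ u → remove S v u ≡ true → Adj T v u → Adj G (φ u) y) →
                  Embeds S (updateAt φ v (λ _ → y))
  embeds-extend {S} {φ} v y Sv old Ok-y y-unused y-beside = record
    { injective = injective′ ; admissible = admissible′ ; homomorphic = homomorphic′ }
    where
      ψ = updateAt φ v (λ _ → y)
      ψ-at : ∀ a → (a ≡ v × ψ a ≡ y) ⊎ (a ≢ v × ψ a ≡ φ a)
      ψ-at a with a ≟ v
      ... | yes refl = inj₁ (refl , updateAt-updates v φ)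
      ... | no a≢v   = inj₂ (a≢v , updateAt-minimal a v φ a≢v)
      kept : ∀ {a} → S a ≡ true → a ≢ v → remove S v a ≡ true
      kept {a} Sa a≢v = remove-∈ S v a Sa a≢v
      not-y : ∀ a → remove S v a ≡ true → φ a ≢ y
      not-y a r refl with () ← trans (sym (image-∋ φ (remove S v) a r)) y-unused
      injective′ : ∀ a b → S a ≡ true → S b ≡ true → ψ a ≡ ψ b → a ≡ b
      injective′ a b Sa Sb e with ψ-at a | ψ-at b
      ... | inj₁ (refl , _)   | inj₁ (refl , _)   = refl
      ... | inj₁ (refl , ψa)  | inj₂ (b≢v , ψb)   = ⊥-elim (not-y b (kept Sb b≢v) (trans (sym ψb) (trans (sym e) ψa)))
      ... | inj₂ (a≢v , ψa)   | inj₁ (refl , ψb)  = ⊥-elim (not-y a (kept Sa a≢v) (trans (sym ψa) (trans e ψb)))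
      ... | inj₂ (a≢v , ψa)   | inj₂ (b≢v , ψb)   =
        injective old a b (kept Sa a≢v) (kept Sb b≢v) (trans (sym ψa) (trans e ψb))
      admissible′ : ∀ a → S a ≡ true → Ok a (ψ a)
      admissible′ a Sa with ψ-at a
      ... | inj₁ (refl , ψa) = subst (Ok v) (sym ψa) Ok-y
      ... | inj₂ (a≢v , ψa)  = subst (Ok a) (sym ψa) (admissible old a (kept Sa a≢v))
      homomorphic′ : ∀ a b → S a ≡ true → S b ≡ true → Adj T a b → Adj G (ψ a) (ψ b)
      homomorphic′ a b Sa Sb a~b with ψ-at a | ψ-at b
      ... | inj₁ (refl , _)  | inj₁ (refl , _)  = ⊥-elim (adj⇒≢ a~b refl)
      ... | inj₁ (refl , ψa) | inj₂ (b≢v , ψb) =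
        subst₂ (Adj G) (sym ψa) (sym ψb) (trans (Graph.sym G y (φ b)) (y-beside b (kept Sb b≢v) a~b))
      ... | inj₂ (a≢v , ψa)  | inj₁ (refl , ψb) =
        subst₂ (Adj G) (sym ψa) (sym ψb) (y-beside a (kept Sa a≢v) (trans (Graph.sym T v a) a~b))
      ... | inj₂ (a≢v , ψa)  | inj₂ (b≢v , ψb) =
        subst₂ (Adj G) (sym ψa) (sym ψb) (homomorphic old a b (kept Sa a≢v) (kept Sb b≢v) a~b)

  image-small : ∀ {S} → S ⊆ Dom → ∀ v → S v ≡ true → (φ : Fin k → Fin n) → count (image φ (remove S v)) < count Dom
  image-small {S} S⊆Dom v Sv φ = ≤-<-trans (count-image φ (remove S v))
    (<-≤-trans (≤-reflexive (sym (count-remove S v Sv))) (count-mono S⊆Dom))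

  add-leaf : ∀ {S} → S ⊆ Dom → ∀ v → S v ≡ true →
             (∀ u u′ → S u ≡ true → S u′ ≡ true → Adj T v u → Adj T v u′ → u ≡ u′) →
             (φ : Fin k → Fin n) → Embeds (remove S v) φ → Σ (Fin k → Fin n) (Embeds S)
  add-leaf {S} S⊆Dom v Sv leaf φ old with any? (λ u → (remove S v u ≟𝔹 true) ×-dec (adj T v u ≟𝔹 true))
  ... | yes (u , r , v~u) with place-beside u v (φ u) (image φ (remove S v)) (S⊆Dom u (remove-⊆ S v u r))
                                 (S⊆Dom v Sv) (trans (Graph.sym T u v) v~u) (admissible old u r) (image-small S⊆Dom v Sv φ)
  ...   | y , φu~y , Ok-y , unused = updateAt φ v (λ _ → y) , embeds-extend v y Sv old Ok-y unused beside
    where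
      beside : ∀ u′ → remove S v u′ ≡ true → Adj T v u′ → Adj G (φ u′) y
      beside u′ r′ v~u′ = subst (λ w → Adj G (φ w) y)
                                (leaf u u′ (remove-⊆ S v u r) (remove-⊆ S v u′ r′) v~u v~u′) φu~y
  add-leaf {S} S⊆Dom v Sv leaf φ old | no isolated
    with place v (image φ (remove S v)) (S⊆Dom v Sv) (image-small S⊆Dom v Sv φ)
  ...   | y , Ok-y , unused = updateAt φ v (λ _ → y) ,
          embeds-extend v y Sv old Ok-y unused (λ u′ r′ v~u′ → ⊥-elim (isolated (u′ , r′ , v~u′)))

  -- A vertex with at most one neighbour in S is embedded last, next to the image of that neighbour.
  embed : ∀ s S → count S ≡ s → S ⊆ Dom → Σ (Fin k → Fin n) (Embeds S)
  embed zero    S |S|≡0   _     = (λ _ → junk) , embeds-∅ (λ _ → junk) |S|≡0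
  embed (suc s) S |S|≡1+s S⊆Dom with forest-leaf acyclic S (subst (1 ≤_) (sym |S|≡1+s) (s≤s z≤n))
  ... | v , Sv , leaf with embed s (remove S v) (suc-injective (trans (sym (count-remove S v Sv)) |S|≡1+s))
                                 (λ w r → S⊆Dom w (remove-⊆ S v w r))
  ...   | φ , old = add-leaf S⊆Dom v Sv leaf φ old

module Rationals where

  open import Defs using (⟦_⟧)
  open import Data.Nat as ℕ using (ℕ; suc)
  import Data.Nat.Properties as ℕ
  open import Data.Integer as ℤ using (+_)
  import Data.Integer.Properties as ℤ
  open import Data.Integer.Solver using (module +-*-Solver)
  open import Data.Rational using (mkℚ; 0ℚ; 1ℚ; _/_; _≤_; _<_; _*_; _-_; -_; ∣_∣; toℚᵘ; nonNegative; positive)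
  open import Data.Rational.Properties
  open import Data.Rational.Unnormalised as ℚᵘ using (mkℚᵘ; _≃_; *≡*)
  import Data.Rational.Unnormalised.Properties as ℚᵘ
  open import Data.Rational.Solver using () renaming (module +-*-Solver to ℚ-Solver)
  open import Data.Product using (∃; _,_)
  open import Data.Sum using (inj₁; inj₂)
  open import Data.Empty using (⊥-elim)
  open import Relation.Binary.PropositionalEquality

  toℚᵘ-⟦⟧ : ∀ n → toℚᵘ ⟦ n ⟧ ≃ mkℚᵘ (+ n) 0
  toℚᵘ-⟦⟧ n = toℚᵘ-fromℚᵘ (mkℚᵘ (+ n) 0)

  ⟦⟧-homo-+ : ∀ a b → ⟦ a ℕ.+ b ⟧ ≡ ⟦ a ⟧ Data.Rational.+ ⟦ b ⟧
  ⟦⟧-homo-+ a b = toℚᵘ-injective (ℚᵘ.≃-trans (toℚᵘ-⟦⟧ (a ℕ.+ b)) (ℚᵘ.≃-trans sum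
    (ℚᵘ.≃-sym (ℚᵘ.≃-trans (toℚᵘ-homo-+ ⟦ a ⟧ ⟦ b ⟧) (ℚᵘ.+-cong (toℚᵘ-⟦⟧ a) (toℚᵘ-⟦⟧ b))))))
    where
      open +-*-Solver using (solve; _:+_; _:*_; _:=_; con)
      sum : mkℚᵘ (+ (a ℕ.+ b)) 0 ≃ mkℚᵘ (+ a) 0 ℚᵘ.+ mkℚᵘ (+ b) 0
      sum = *≡* (trans (cong (ℤ._* + 1) (ℤ.pos-+ a b))
                  (solve 2 (λ x y → (x :+ y) :* con (+ 1) := (x :* con (+ 1) :+ y :* con (+ 1)) :* con (+ 1))
                         refl (+ a) (+ b)))

  ⟦⟧-homo-* : ∀ a b → ⟦ a ℕ.* b ⟧ ≡ ⟦ a ⟧ * ⟦ b ⟧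
  ⟦⟧-homo-* a b = toℚᵘ-injective (ℚᵘ.≃-trans (toℚᵘ-⟦⟧ (a ℕ.* b)) (ℚᵘ.≃-trans product
    (ℚᵘ.≃-sym (ℚᵘ.≃-trans (toℚᵘ-homo-* ⟦ a ⟧ ⟦ b ⟧) (ℚᵘ.*-cong (toℚᵘ-⟦⟧ a) (toℚᵘ-⟦⟧ b))))))
    where
      product : mkℚᵘ (+ (a ℕ.* b)) 0 ≃ mkℚᵘ (+ a) 0 ℚᵘ.* mkℚᵘ (+ b) 0
      product = *≡* (cong (ℤ._* + 1) (ℤ.pos-* a b))

  ⟦⟧-mono-≤ : ∀ {a b} → a ℕ.≤ b → ⟦ a ⟧ ≤ ⟦ b ⟧
  ⟦⟧-mono-≤ {a} {b} a≤b = toℚᵘ-cancel-≤ (ℚᵘ.≤-respʳ-≃ (ℚᵘ.≃-sym (toℚᵘ-⟦⟧ b)) (ℚᵘ.≤-respˡ-≃ (ℚᵘ.≃-sym (toℚᵘ-⟦⟧ a))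
    (ℚᵘ.*≤* (subst₂ ℤ._≤_ (sym (ℤ.*-identityʳ (+ a))) (sym (ℤ.*-identityʳ (+ b))) (ℤ.+≤+ a≤b)))))

  ⟦⟧-cancel-≤ : ∀ {a b} → ⟦ a ⟧ ≤ ⟦ b ⟧ → a ℕ.≤ b
  ⟦⟧-cancel-≤ {a} {b} a≤b with ℚᵘ.≤-respʳ-≃ (toℚᵘ-⟦⟧ b) (ℚᵘ.≤-respˡ-≃ (toℚᵘ-⟦⟧ a) (toℚᵘ-mono-≤ a≤b))
  ... | ℚᵘ.*≤* a≤b′ = ℤ.drop‿+≤+ (subst₂ ℤ._≤_ (ℤ.*-identityʳ (+ a)) (ℤ.*-identityʳ (+ b)) a≤b′)

  ⟦⟧-mono-< : ∀ {a b} → a ℕ.< b → ⟦ a ⟧ < ⟦ b ⟧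
  ⟦⟧-mono-< {a} {b} a<b = toℚᵘ-cancel-< (ℚᵘ.<-respʳ-≃ (ℚᵘ.≃-sym (toℚᵘ-⟦⟧ b)) (ℚᵘ.<-respˡ-≃ (ℚᵘ.≃-sym (toℚᵘ-⟦⟧ a))
    (ℚᵘ.*<* (subst₂ ℤ._<_ (sym (ℤ.*-identityʳ (+ a))) (sym (ℤ.*-identityʳ (+ b))) (ℤ.+<+ a<b)))))

  ⟦⟧-cancel-< : ∀ {a b} → ⟦ a ⟧ < ⟦ b ⟧ → a ℕ.< b
  ⟦⟧-cancel-< {a} {b} a<b with ℚᵘ.<-respʳ-≃ (toℚᵘ-⟦⟧ b) (ℚᵘ.<-respˡ-≃ (toℚᵘ-⟦⟧ a) (toℚᵘ-mono-< a<b))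
  ... | ℚᵘ.*<* a<b′ = ℤ.drop‿+<+ (subst₂ ℤ._<_ (ℤ.*-identityʳ (+ a)) (ℤ.*-identityʳ (+ b)) a<b′)

  0≤⟦⟧ : ∀ n → 0ℚ ≤ ⟦ n ⟧
  0≤⟦⟧ n = ⟦⟧-mono-≤ {0} {n} ℕ.z≤n

  *-denominator : ∀ p e s → toℚᵘ p ≃ mkℚᵘ (+ e) s → p * ⟦ suc s ⟧ ≡ ⟦ e ⟧
  *-denominator p e s p≃e/s = toℚᵘ-injective (ℚᵘ.≃-trans (toℚᵘ-homo-* p ⟦ suc s ⟧)
    (ℚᵘ.≃-trans (ℚᵘ.*-cong p≃e/s (toℚᵘ-⟦⟧ (suc s))) (ℚᵘ.≃-trans cancel (ℚᵘ.≃-sym (toℚᵘ-⟦⟧ e)))))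
    where
      cancel : mkℚᵘ (+ e) s ℚᵘ.* mkℚᵘ (+ suc s) 0 ≃ mkℚᵘ (+ e) 0
      cancel = *≡* (trans (ℤ.*-identityʳ _) (cong (λ z → + e ℤ.* + suc z) (sym (ℕ.*-identityʳ s))))

  ≤-*ʳ : ∀ {p q} r → 0ℚ ≤ r → p ≤ q → p * r ≤ q * r
  ≤-*ʳ r 0≤r = *-monoʳ-≤-nonNeg r {{nonNegative 0≤r}}

  ≤-*ˡ : ∀ {p q} r → 0ℚ ≤ r → p ≤ q → r * p ≤ r * q
  ≤-*ˡ r 0≤r = *-monoˡ-≤-nonNeg r {{nonNegative 0≤r}}

  <-*ʳ : ∀ {p q} r → 0ℚ < r → p < q → p * r < q * r
  <-*ʳ r 0<r = *-monoˡ-<-pos r {{positive 0<r}}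

  ≤-cancel-*ʳ : ∀ {p q} r → 0ℚ < r → p * r ≤ q * r → p ≤ q
  ≤-cancel-*ʳ r 0<r = *-cancelʳ-≤-pos r {{positive 0<r}}

  <-cancel-*ʳ : ∀ {p q} r → 0ℚ ≤ r → p * r < q * r → p < q
  <-cancel-*ʳ r 0≤r = *-cancelʳ-<-nonNeg r {{nonNegative 0≤r}}

  0≤* : ∀ {p q} → 0ℚ ≤ p → 0ℚ ≤ q → 0ℚ ≤ p * q
  0≤* {p} {q} 0≤p 0≤q = nonNegative⁻¹ (p * q) {{nonNeg*nonNeg⇒nonNeg p {{nonNegative 0≤p}} q {{nonNegative 0≤q}}}}

  0<* : ∀ {p q} → 0ℚ < p → 0ℚ < q → 0ℚ < p * q
  0<* {p} {q} 0<p 0<q = positive⁻¹ (p * q) {{pos*pos⇒pos p {{positive 0<p}} q {{positive 0<q}}}}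

  ∣p-q∣≤r⇒q-r≤p : ∀ p q r → ∣ p - q ∣ ≤ r → q - r ≤ p
  ∣p-q∣≤r⇒q-r≤p p q r ∣p-q∣≤r = begin
    q - r               ≤⟨ +-monoʳ-≤ q (neg-antimono-≤ (≤-trans (-x≤∣x∣ (p - q)) ∣p-q∣≤r)) ⟩
    q - (- (p - q))     ≡⟨ solve 2 (λ p q → q :- (:- (p :- q)) := p) refl p q ⟩
    p                   ∎
    where
      open ≤-Reasoning
      open ℚ-Solver using (solve; :-_; _:-_; _:=_)
      -x≤∣x∣ : ∀ x → - x ≤ ∣ x ∣
      -x≤∣x∣ x with ∣p∣≡p∨∣p∣≡-p x
      ... | inj₂ ∣x∣≡-x = ≤-reflexive (sym ∣x∣≡-x)
      ... | inj₁ ∣x∣≡x  = ≤-trans (neg-antimono-≤ (∣p∣≡p⇒0≤p ∣x∣≡x)) (0≤∣p∣ x)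

  /-*-cancel : ∀ e s → (+ e / suc s) * ⟦ suc s ⟧ ≡ ⟦ e ⟧
  /-*-cancel e s = *-denominator (+ e / suc s) e s (toℚᵘ-fromℚᵘ (mkℚᵘ (+ e) s))

  archimedean : ∀ p → 0ℚ < p → ∃ λ N → 1ℚ ≤ p * ⟦ N ⟧
  archimedean p@(mkℚ (+ e) s _) 0<p = suc s , subst (1ℚ ≤_) (sym p*[1+s]≡e) (⟦⟧-mono-≤ 0<e)
    where
      p*[1+s]≡e = *-denominator p e s ℚᵘ.≃-refl
      0<e : 0 ℕ.< e
      0<e = ⟦⟧-cancel-< (subst (0ℚ <_) p*[1+s]≡e (0<* 0<p (⟦⟧-mono-< {0} {suc s} ℕ.z<s)))
  archimedean p@(mkℚ ℤ.-[1+ _ ] _ _) 0<p = ⊥-elim (<-asym 0<p (negative⁻¹ p))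

module Density where

  open Counting
  open Rationals
  open import Defs hiding (sym)
  open import Data.Nat as ℕ using (ℕ; zero; suc)
  import Data.Nat.Properties as ℕ
  open import Data.Integer using (+_)
  open import Data.Rational using (ℚ; 0ℚ; 1ℚ; _/_; _≤_; _<_; _+_; _*_; _-_; -_; ∣_∣; _≤ᵇ_)
  open import Data.Rational.Properties
  open import Data.Rational.Solver using () renaming (module +-*-Solver to ℚ-Solver)
  open import Data.Bool using (Bool; true; false; T; _∧_; not; if_then_else_)
  open import Data.Bool.Properties using (∧-conicalˡ; ∧-conicalʳ; not-injective)
  open import Data.Fin using (Fin; zero; suc)
  open import Data.Empty using (⊥-elim)
  open import Relation.Nullary using (Dec; yes; no)
  open import Relation.Binary.PropositionalEquality

  ratio : ℕ → ℕ → ℚ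
  ratio e zero    = 0ℚ
  ratio e (suc s) = + e / suc s

  density≡ratio : ∀ {n} (G : Graph n) X Y → density G X Y ≡ ratio (eCount G X Y) (count X ℕ.* count Y)
  density≡ratio G X Y with count X ℕ.* count Y
  ... | zero  = refl
  ... | suc s = refl

  density-sym : ∀ {n} (G : Graph n) X Y → density G X Y ≡ density G Y X
  density-sym G X Y = begin
    density G X Y                                          ≡⟨ density≡ratio G X Y ⟩
    ratio (eCount G X Y) (count X ℕ.* count Y)              ≡⟨ cong₂ ratio (eCount-sym G X Y) (ℕ.*-comm (count X) (count Y)) ⟩
    ratio (eCount G Y X) (count Y ℕ.* count X)              ≡⟨ density≡ratio G Y X ⟨
    density G Y X                                          ∎
    where open ≡-Reasoning

  density≤1 : ∀ {n} (G : Graph n) X Y → density G X Y ≤ 1ℚ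
  density≤1 G X Y = subst (_≤ 1ℚ) (sym (density≡ratio G X Y)) (ratio≤1 (eCount≤ G X Y))
    where
      ratio≤1 : ∀ {e s} → e ℕ.≤ s → ratio e s ≤ 1ℚ
      ratio≤1 {e} {zero}  _   = ≤ᵇ⇒≤ _
      ratio≤1 {e} {suc s} e≤s = ≤-cancel-*ʳ ⟦ suc s ⟧ (⟦⟧-mono-< {0} {suc s} ℕ.z<s) (begin
        (+ e / suc s) * ⟦ suc s ⟧   ≡⟨ /-*-cancel e s ⟩
        ⟦ e ⟧                       ≤⟨ ⟦⟧-mono-≤ e≤s ⟩
        ⟦ suc s ⟧                   ≡⟨ *-identityˡ ⟦ suc s ⟧ ⟨
        1ℚ * ⟦ suc s ⟧              ∎)
        where open ≤-Reasoning

  regular-sym : ∀ {n} (G : Graph n) {ε} X Y → RegularPair G ε X Y → RegularPair G ε Y X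
  regular-sym G X Y reg Y′ X′ Y′⊆Y X′⊆X big-Y′ big-X′ =
    subst₂ (λ a b → ∣ a - b ∣ ≤ _) (density-sym G X′ Y′) (density-sym G X Y) (reg X′ Y′ X′⊆X Y′⊆Y big-X′ big-Y′)

  -- Opaque, since unfolding the rational comparison during unification is prohibitively slow.
  opaque
    typical : ∀ {n} → Graph n → ℚ → VSet n → Fin n → Bool
    typical G t Y x = t ≤ᵇ ⟦ count (λ y → Y y ∧ adj G x y) ⟧

    typical⇒ : ∀ {n} (G : Graph n) t Y x → typical G t Y x ≡ true → t ≤ ⟦ count (λ y → Y y ∧ adj G x y) ⟧
    typical⇒ G t Y x typ = ≤ᵇ⇒≤ (subst T (sym typ) _)

    atypical⇒ : ∀ {n} (G : Graph n) t Y x → typical G t Y x ≡ false → ⟦ count (λ y → Y y ∧ adj G x y) ⟧ < t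
    atypical⇒ G t Y x atyp = ≰⇒> (λ t≤ → subst T atyp (≤⇒≤ᵇ t≤))

  atypical : ∀ {n} → Graph n → ℚ → VSet n → VSet n → VSet n
  atypical G t X Y x = X x ∧ not (typical G t Y x)

  private
    *-suc : ∀ q c → q * ⟦ suc c ⟧ ≡ q + q * ⟦ c ⟧
    *-suc q c = trans (cong (q *_) (⟦⟧-homo-+ 1 c))
                      (trans (*-distribˡ-+ q ⟦ 1 ⟧ ⟦ c ⟧) (cong (_+ q * ⟦ c ⟧) (*-identityʳ q)))

  sumF-≤ : ∀ {n} (X : Fin n → Bool) (f : Fin n → ℕ) q → (∀ x → X x ≡ true → ⟦ f x ⟧ ≤ q) →
           ⟦ sumF (λ x → if X x then f x else 0) ⟧ ≤ q * ⟦ count X ⟧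
  sumF-≤ {zero}  X f q f≤q = ≤-reflexive (sym (*-zeroʳ q))
  sumF-≤ {suc n} X f q f≤q with X zero in X₀
  ... | false = sumF-≤ (λ x → X (suc x)) (λ x → f (suc x)) q (λ x → f≤q (suc x))
  ... | true  = begin
    ⟦ f zero ℕ.+ rest ⟧               ≡⟨ ⟦⟧-homo-+ (f zero) rest ⟩
    ⟦ f zero ⟧ + ⟦ rest ⟧             ≤⟨ +-mono-≤ (f≤q zero X₀) (sumF-≤ (λ x → X (suc x)) (λ x → f (suc x)) q (λ x → f≤q (suc x))) ⟩
    q + q * ⟦ count (λ x → X (suc x)) ⟧ ≡⟨ *-suc q (count (λ x → X (suc x))) ⟨
    q * ⟦ suc (count (λ x → X (suc x))) ⟧ ∎
    where
      open ≤-Reasoning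
      rest = sumF (λ x → if X (suc x) then f (suc x) else 0)

  sumF-< : ∀ {n} (X : Fin n → Bool) (f : Fin n → ℕ) q → (∀ x → X x ≡ true → ⟦ f x ⟧ < q) →
           1 ℕ.≤ count X → ⟦ sumF (λ x → if X x then f x else 0) ⟧ < q * ⟦ count X ⟧
  sumF-< {suc n} X f q f<q 1≤|X| with X zero in X₀
  ... | false = sumF-< (λ x → X (suc x)) (λ x → f (suc x)) q (λ x → f<q (suc x)) 1≤|X|
  ... | true  = begin-strict
    ⟦ f zero ℕ.+ rest ⟧               ≡⟨ ⟦⟧-homo-+ (f zero) rest ⟩
    ⟦ f zero ⟧ + ⟦ rest ⟧             <⟨ +-mono-<-≤ (f<q zero X₀)
                                          (sumF-≤ (λ x → X (suc x)) (λ x → f (suc x)) q (λ x Xx → <⇒≤ (f<q (suc x) Xx))) ⟩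
    q + q * ⟦ count (λ x → X (suc x)) ⟧ ≡⟨ *-suc q (count (λ x → X (suc x))) ⟨
    q * ⟦ suc (count (λ x → X (suc x))) ⟧ ∎
    where
      open ≤-Reasoning
      rest = sumF (λ x → if X (suc x) then f (suc x) else 0)

  ratio< : ∀ e P τ → 1 ℕ.≤ P → ⟦ e ⟧ < τ * ⟦ P ⟧ → ratio e P < τ
  ratio< e (suc s) τ _ e<τP = <-cancel-*ʳ ⟦ suc s ⟧ (0≤⟦⟧ (suc s))
    (subst (_< τ * ⟦ suc s ⟧) (sym (/-*-cancel e s)) e<τP)

  low-degrees⇒density< : ∀ {n} (G : Graph n) X Y τ → 1 ℕ.≤ count X → 1 ℕ.≤ count Y →
                         (∀ x → X x ≡ true → ⟦ count (λ y → Y y ∧ adj G x y) ⟧ < τ * ⟦ count Y ⟧) →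
                         density G X Y < τ
  low-degrees⇒density< G X Y τ 1≤|X| 1≤|Y| low = subst (_< τ) (sym (density≡ratio G X Y))
    (ratio< (eCount G X Y) (count X ℕ.* count Y) τ (ℕ.*-mono-≤ 1≤|X| 1≤|Y|) (begin-strict
      ⟦ eCount G X Y ⟧                <⟨ sumF-< X (λ x → count (λ y → Y y ∧ adj G x y)) (τ * ⟦ count Y ⟧) low 1≤|X| ⟩
      τ * ⟦ count Y ⟧ * ⟦ count X ⟧   ≡⟨ solve 3 (λ t y x → t :* y :* x := t :* (x :* y)) refl τ ⟦ count Y ⟧ ⟦ count X ⟧ ⟩
      τ * (⟦ count X ⟧ * ⟦ count Y ⟧) ≡⟨ cong (τ *_) (⟦⟧-homo-* (count X) (count Y)) ⟨
      τ * ⟦ count X ℕ.* count Y ⟧     ∎))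
    where
      open ≤-Reasoning
      open ℚ-Solver using (solve; _:*_; _:=_)

  few-atypical : ∀ {n} (G : Graph n) {ε d τ} X Y → RegularPair G ε X Y → d ≤ density G X Y →
                 0ℚ < ε → ε ≤ 1ℚ → τ ≤ d - ε → 1 ℕ.≤ count X → 1 ℕ.≤ count Y →
                 ⟦ count (atypical G (τ * ⟦ count Y ⟧) X Y) ⟧ < ε * ⟦ count X ⟧
  few-atypical G {ε} {d} {τ} X Y reg d≤ 0<ε ε≤1 τ≤d-ε 1≤|X| 1≤|Y| = decide (ε * ⟦ count X ⟧ ≤? ⟦ count B ⟧)
    where
      B = atypical G (τ * ⟦ count Y ⟧) X Y
      Y-large : ε * ⟦ count Y ⟧ ≤ ⟦ count Y ⟧
      Y-large = ≤-trans (≤-*ʳ ⟦ count Y ⟧ (0≤⟦⟧ (count Y)) ε≤1) (≤-reflexive (*-identityˡ ⟦ count Y ⟧))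
      low : ∀ x → B x ≡ true → ⟦ count (λ y → Y y ∧ adj G x y) ⟧ < τ * ⟦ count Y ⟧
      low x Bx = atypical⇒ G (τ * ⟦ count Y ⟧) Y x (not-injective (∧-conicalʳ (X x) _ Bx))
      decide : Dec (ε * ⟦ count X ⟧ ≤ ⟦ count B ⟧) → ⟦ count B ⟧ < ε * ⟦ count X ⟧
      decide (no small)  = ≰⇒> small
      decide (yes large) = ⊥-elim (<-irrefl refl (<-≤-trans (low-degrees⇒density< G B Y τ 1≤|B| 1≤|Y| low) τ≤d[B,Y]))
        where
          1≤|B| : 1 ℕ.≤ count B
          1≤|B| = ⟦⟧-cancel-< {0} (<-≤-trans (0<* 0<ε (⟦⟧-mono-< {0} 1≤|X|)) large)
          τ≤d[B,Y] : τ ≤ density G B Y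
          τ≤d[B,Y] = begin
            τ                     ≤⟨ τ≤d-ε ⟩
            d - ε                 ≤⟨ +-monoˡ-≤ (- ε) d≤ ⟩
            density G X Y - ε     ≤⟨ ∣p-q∣≤r⇒q-r≤p _ _ ε (reg B Y (λ x → ∧-conicalˡ (X x) _) (λ _ Yy → Yy) large Y-large) ⟩
            density G B Y         ∎
            where open ≤-Reasoning

module PairEmbedding {k n : ℕ} (T : Graph k) (acyclic : ¬ Cycle T)
  (Dom side : VSet k) (alternating : ∀ u v → Dom u ≡ true → Adj T u v → side v ≡ not (side u))
  (G : Graph n) (X : Bool → VSet n) (U : VSet n) (t : ℚ) (m : ℕ)
  (|X|≡m : ∀ b → count (X b) ≡ m) (1≤m : 1 ℕ.≤ m) (t≤m : t ℚ.≤ ⟦ m ⟧)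
  (room : ∀ b → ⟦ count (Density.atypical G t (X b) (X (not b))) ℕ.+ count U ℕ.+ count Dom ⟧ ℚ.≤ t)
  where

  open Counting
  open Rationals
  open Density using (typical; typical⇒; atypical)
  open import Defs hiding (sym)
  open import Data.Nat using (_<_)
  open import Data.Nat.Properties using (≤-trans; ≤-<-trans; <-≤-trans; +-mono-≤; +-monoʳ-<; +-assoc; ≤-reflexive)
  open import Data.Bool using (_∧_; _∨_)
  open import Data.Bool.Properties using (∧-conicalˡ; ∧-conicalʳ; ∨-conicalˡ; ∨-conicalʳ; not-injective)
  open import Data.Product using (Σ; _,_; proj₁)
  open import Data.Rational.Properties using () renaming (≤-trans to ℚ≤-trans)
  open import Relation.Binary.PropositionalEquality

  private
    ∧≡true : ∀ a b → a ∧ b ≡ true → a ≡ true × b ≡ true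
    ∧≡true a b h = ∧-conicalˡ a b h , ∧-conicalʳ a b h

    ∨≡false : ∀ a b → a ∨ b ≡ false → a ≡ false × b ≡ false
    ∨≡false a b h = ∨-conicalˡ a b h , ∨-conicalʳ a b h

  Ok : Fin k → Fin n → Set
  Ok v y = X (side v) y ≡ true × typical G t (X (not (side v))) y ≡ true × U y ≡ false

  free-vertex : ∀ b (A Used : VSet n) → A ⊆ X b → t ℚ.≤ ⟦ count A ⟧ → count Used < count Dom →
                ∃ λ y → A y ≡ true × typical G t (X (not b)) y ≡ true × U y ≡ false × Used y ≡ false
  free-vertex b A Used A⊆Xb t≤|A| few =
    let y , Ay , not-bad = count-avoid A Bad |Bad|<|A|
        not-atypical , not-U-or-Used = ∨≡false (atypical G t (X b) (X (not b)) y) (U y ∨ Used y) not-bad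
        ∉U , unused = ∨≡false (U y) (Used y) not-U-or-Used
    in y , Ay , not-injective (subst (λ z → z ∧ not (typical G t (X (not b)) y) ≡ false) (A⊆Xb y Ay) not-atypical) ,
       ∉U , unused
    where
      Atypical = atypical G t (X b) (X (not b))
      Bad = λ y → Atypical y ∨ (U y ∨ Used y)
      |Bad|<|A| : count Bad < count A
      |Bad|<|A| = ≤-<-trans (≤-trans (count-∨ Atypical (λ y → U y ∨ Used y)) (+-mono-≤ (≤-reflexive refl) (count-∨ U Used)))
        (<-≤-trans (subst (count Atypical ℕ.+ (count U ℕ.+ count Used) <_) (sym (+-assoc (count Atypical) (count U) (count Dom)))
                     (+-monoʳ-< (count Atypical) (+-monoʳ-< (count U) few)))
                   (⟦⟧-cancel-≤ (ℚ≤-trans (room b) t≤|A|)))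

  place : ∀ v (Used : VSet n) → Dom v ≡ true → count Used < count Dom → ∃ λ y → Ok v y × Used y ≡ false
  place v Used _ few =
    let y , Xy , typ , ∉U , unused = free-vertex (side v) (X (side v)) Used (λ _ Xy → Xy)
                                       (subst (λ c → t ℚ.≤ ⟦ c ⟧) (sym (|X|≡m (side v))) t≤m) few
    in y , (Xy , typ , ∉U) , unused

  place-beside : ∀ u v x (Used : VSet n) → Dom u ≡ true → Dom v ≡ true → Adj T u v → Ok u x →
                 count Used < count Dom → ∃ λ y → Adj G x y × Ok v y × Used y ≡ false
  place-beside u v x Used Du _ u~v (_ , typ-x , _) few =
    let y , Ay , typ , ∉U , unused = free-vertex (side v) A Used (λ y → ∧-conicalˡ (X (side v) y) (adj G x y))
                                       t≤|A| few
        Xy , x~y = ∧≡true (X (side v) y) (adj G x y) Ay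
    in y , x~y , (Xy , typ , ∉U) , unused
    where
      A = λ y → X (side v) y ∧ adj G x y
      t≤|A| : t ℚ.≤ ⟦ count A ⟧
      t≤|A| = subst (λ b → t ℚ.≤ ⟦ count (λ y → X b y ∧ adj G x y) ⟧) (sym (alternating u v Du u~v))
                    (typical⇒ G t (X (not (side u))) x typ-x)

  junk : Fin n
  junk = proj₁ (count>0⇒∃ (X true) (subst (1 ℕ.≤_) (sym (|X|≡m true)) 1≤m))

  module Greedy = GreedyEmbedding T acyclic G junk Dom Ok place place-beside
  open Greedy public using (Embeds; module Embeds)

  embedding : Σ (Fin k → Fin n) (Embeds Dom)
  embedding = Greedy.embed (count Dom) Dom refl (λ _ Dv → Dv)

module FinePartition {k p : ℕ} (part : Fin k → Data.Maybe.Maybe (Fin p)) (dd : Fin p → Bool) where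

  open Counting
  open import Defs hiding (sym)
  open import Data.Nat using (zero; suc; _+_; _≤_; z≤n; s≤s)
  open import Data.Fin using (zero; suc)
  open import Data.Nat.Properties using (≤-trans; ≤-reflexive; +-mono-≤)
  open import Data.Bool using (_∧_; _∨_)
  open import Data.Bool.Properties using (∧-zeroʳ; ∧-identityʳ)
  open import Data.Maybe using (nothing; just)
  open import Data.Fin.Properties using (_≟_)
  open import Data.Product using (_,_)
  open import Data.Empty using (⊥-elim)
  open import Relation.Nullary.Decidable using (dec-true)
  open import Relation.Binary.PropositionalEquality

  inD″ : VSet k
  inD″ v = anyF (λ i → inK part i v ∧ dd i)

  inDom⇒inW∨inD″ : ∀ v → inDom part dd v ≡ true → (inW part v ∨ inD″ v) ≡ true
  inDom⇒inW∨inD″ v v∈ with part v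
  ... | nothing = refl
  ... | just i  = ∃⇒anyF _ i (cong₂ _∧_ (dec-true (i ≟ i) refl) v∈)

  inDom⇒D″ : ∀ v → inDom part dd v ≡ true → inW part v ≡ false → ∃ λ i → inK part i v ≡ true × dd i ≡ true
  inDom⇒D″ v v∈ v∉W with part v
  ... | just i = i , dec-true (i ≟ i) refl , v∈

  count-inD″ : (∀ i → dd i ≡ true → count (inK part i) ≡ 1) → count inD″ ≤ count dd
  count-inD″ single = begin
    count inD″                                                 ≡⟨ count≡sumF inD″ ⟩
    sumF (λ v → indicator (inD″ v))                            ≤⟨ sumF-mono (λ v → indicator-anyF (λ i → inK part i v ∧ dd i)) ⟩
    sumF (λ v → sumF (λ i → indicator (inK part i v ∧ dd i)))  ≡⟨ sumF-swap (λ v i → indicator (inK part i v ∧ dd i)) ⟩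
    sumF (λ i → sumF (λ v → indicator (inK part i v ∧ dd i)))  ≡⟨ sumF-cong part-size ⟩
    sumF (λ i → indicator (dd i))                              ≡⟨ count≡sumF dd ⟨
    count dd                                                   ∎
    where
      open Data.Nat.Properties.≤-Reasoning
      indicator-anyF : ∀ {n} (P : Fin n → Bool) → indicator (anyF P) ≤ sumF (λ i → indicator (P i))
      indicator-anyF {zero}  P = z≤n
      indicator-anyF {suc n} P with P zero
      ... | true  = s≤s z≤n
      ... | false = indicator-anyF (λ i → P (suc i))
      part-size : ∀ i → sumF (λ v → indicator (inK part i v ∧ dd i)) ≡ indicator (dd i)
      part-size i with dd i in ddᵢ
      ... | false = trans (sumF-cong (λ v → cong indicator (∧-zeroʳ (inK part i v)))) (sumF-zero k)
      ... | true  = trans (sumF-cong (λ v → cong indicator (∧-identityʳ (inK part i v))))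
                          (trans (sym (count≡sumF (inK part i))) (single i ddᵢ))

  count-inDom : (∀ i → dd i ≡ true → count (inK part i) ≡ 1) → count (inDom part dd) ≤ count (inW part) + count dd
  count-inDom single = ≤-trans (count-mono inDom⇒inW∨inD″)
    (≤-trans (count-∨ (inW part) inD″) (+-mono-≤ (≤-reflexive refl) (count-inD″ single)))

  -- W ⊆ V₁ spans no edge, and all neighbours of a singleton of 𝒟'' lie in W.
  alternating : ∀ (T : Graph k) col → ProperColouring T col → (∀ v → inW part v ≡ true → col v ≡ false) →
                (∀ i → dd i ≡ true → count (inK part i) ≡ 1) →
                (∀ i u w → inK part i u ≡ true → Adj T u w → inK part i w ≡ false → inW part w ≡ true) →
                ∀ u v → inDom part dd u ≡ true → Adj T u v → inW part v ≡ not (inW part u)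
  alternating T col proper W⊆V₁ single K-closed u v u∈Dom u~v with inW part u in u∈W
  ... | true with inW part v in v∈W
  ...   | false = refl
  ...   | true  = ⊥-elim (proper u v u~v (trans (W⊆V₁ u u∈W) (sym (W⊆V₁ v v∈W))))
  alternating T col proper W⊆V₁ single K-closed u v u∈Dom u~v | false with inDom⇒D″ u u∈Dom u∈W
  ... | i , u∈Kᵢ , ddᵢ with inK part i v in v∈Kᵢ
  ...   | false = K-closed i u v u∈Kᵢ u~v v∈Kᵢ
  ...   | true with s≤s () ← subst (2 ≤_) (single i ddᵢ)
                               (distinct⇒2≤count (inK part i) u v u∈Kᵢ v∈Kᵢ (Forests.adj⇒≢ T u~v))

module Estimates where

  open Rationals
  open import Data.Nat as ℕ using (ℕ; suc)
  import Data.Nat.Properties as ℕ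
  open import Data.Integer using (+_)
  open import Data.Rational using (ℚ; 0ℚ; 1ℚ; _/_; _≤_; _<_; _+_; _*_; _-_; -_)
  open import Data.Rational.Properties
  open import Data.Rational.Solver using (module +-*-Solver)
  open import Data.Product using (Σ; _×_; _,_)
  open import Data.Empty using (⊥-elim)
  open import Relation.Nullary using (yes; no)
  open import Relation.Binary.PropositionalEquality
  open +-*-Solver using (solve; _:+_; _:*_; :-_; _:=_; con)
  open ≤-Reasoning

  ε≤d/20 : ∀ {d ε} → 0ℚ ≤ d → d ≤ 1ℚ → ε ≤ d * d * (+ 1 / 100) → ε ≤ d * (+ 1 / 20)
  ε≤d/20 {d} {ε} 0≤d d≤1 ε≤d²/100 = begin
    ε                         ≤⟨ ε≤d²/100 ⟩
    d * d * (+ 1 / 100)       ≤⟨ ≤-*ʳ (+ 1 / 100) (≤ᵇ⇒≤ _) (≤-*ˡ d 0≤d d≤1) ⟩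
    d * 1ℚ * (+ 1 / 100)      ≡⟨ solve 1 (λ d → d :* con 1ℚ :* con (+ 1 / 100) := d :* con (+ 1 / 100)) refl d ⟩
    d * (+ 1 / 100)           ≤⟨ ≤-*ˡ d 0≤d (≤ᵇ⇒≤ _) ⟩
    d * (+ 1 / 20)            ∎

  fraction≤1 : ∀ {d} q → 0ℚ ≤ q → q ≤ 1ℚ → d ≤ 1ℚ → d * q ≤ 1ℚ
  fraction≤1 {d} q 0≤q q≤1 d≤1 = begin
    d * q      ≤⟨ ≤-*ʳ q 0≤q d≤1 ⟩
    1ℚ * q     ≡⟨ *-identityˡ q ⟩
    q          ≤⟨ q≤1 ⟩
    1ℚ         ∎

  half≤d-ε : ∀ {d ε} → 0ℚ ≤ d → ε ≤ d * (+ 1 / 20) → d * (+ 1 / 2) ≤ d - ε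
  half≤d-ε {d} {ε} 0≤d ε≤d/20 = begin
    d * (+ 1 / 2)             ≡⟨ solve 1 (λ d → d :* con (+ 1 / 2) := d :+ (:- (d :* con (+ 1 / 2)))) refl d ⟩
    d + - (d * (+ 1 / 2))     ≤⟨ +-monoʳ-≤ d (neg-antimono-≤ (≤-trans ε≤d/20 (≤-*ˡ d 0≤d (≤ᵇ⇒≤ _)))) ⟩
    d - ε                     ∎

  x*x≤y*y⇒x≤y : ∀ {x y} → 0ℚ ≤ y → x * x ≤ y * y → x ≤ y
  x*x≤y*y⇒x≤y {x} {y} 0≤y x²≤y² with x ≤? y
  ... | yes x≤y = x≤y
  ... | no  x≰y = ⊥-elim (<-irrefl refl (begin-strict
    y * y     ≤⟨ ≤-*ˡ y 0≤y (<⇒≤ y<x) ⟩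
    y * x     <⟨ <-*ʳ x (≤-<-trans 0≤y y<x) y<x ⟩
    x * x     ≤⟨ x²≤y² ⟩
    y * y     ∎))
    where y<x = ≰⇒> x≰y

  U-bound : ∀ {d ε} u m → 0ℚ ≤ d → ε ≤ d * d * (+ 1 / 100) →
            ⟦ u ℕ.* u ⟧ ≤ (+ 4 / 1) * ε * ⟦ m ℕ.* m ⟧ → ⟦ u ⟧ ≤ d * (+ 1 / 5) * ⟦ m ⟧
  U-bound {d} {ε} u m 0≤d ε≤d²/100 u²≤4εm² = x*x≤y*y⇒x≤y (0≤* (0≤* 0≤d (≤ᵇ⇒≤ _)) (0≤⟦⟧ m)) (begin
    ⟦ u ⟧ * ⟦ u ⟧                                    ≡⟨ ⟦⟧-homo-* u u ⟨
    ⟦ u ℕ.* u ⟧                                      ≤⟨ u²≤4εm² ⟩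
    (+ 4 / 1) * ε * ⟦ m ℕ.* m ⟧                      ≤⟨ ≤-*ʳ ⟦ m ℕ.* m ⟧ (0≤⟦⟧ (m ℕ.* m)) (≤-*ˡ (+ 4 / 1) (≤ᵇ⇒≤ _) ε≤d²/100) ⟩
    (+ 4 / 1) * (d * d * (+ 1 / 100)) * ⟦ m ℕ.* m ⟧  ≡⟨ cong ((+ 4 / 1) * (d * d * (+ 1 / 100)) *_) (⟦⟧-homo-* m m) ⟩
    (+ 4 / 1) * (d * d * (+ 1 / 100)) * (⟦ m ⟧ * ⟦ m ⟧)
      ≡⟨ solve 2 (λ d m → con (+ 4 / 1) :* (d :* d :* con (+ 1 / 100)) :* (m :* m)
                          := (d :* con (+ 1 / 5) :* m) :* (d :* con (+ 1 / 5) :* m)) refl d ⟦ m ⟧ ⟩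
    d * (+ 1 / 5) * ⟦ m ⟧ * (d * (+ 1 / 5) * ⟦ m ⟧) ∎)

  room-bound : ∀ {d ε} m a b c → ε ≤ d * (+ 1 / 20) → ⟦ a ⟧ ≤ ε * ⟦ m ⟧ →
               ⟦ b ⟧ ≤ d * (+ 1 / 5) * ⟦ m ⟧ → ⟦ c ⟧ ≤ d * (+ 1 / 4) * ⟦ m ⟧ →
               ⟦ a ℕ.+ b ℕ.+ c ⟧ ≤ d * (+ 1 / 2) * ⟦ m ⟧
  room-bound {d} {ε} m a b c ε≤d/20 a≤ b≤ c≤ = begin
    ⟦ a ℕ.+ b ℕ.+ c ⟧                  ≡⟨ trans (⟦⟧-homo-+ (a ℕ.+ b) c) (cong (_+ ⟦ c ⟧) (⟦⟧-homo-+ a b)) ⟩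
    ⟦ a ⟧ + ⟦ b ⟧ + ⟦ c ⟧                ≤⟨ +-mono-≤ (+-mono-≤ (≤-trans a≤ (≤-*ʳ ⟦ m ⟧ (0≤⟦⟧ m) ε≤d/20)) b≤) c≤ ⟩
    d * (+ 1 / 20) * ⟦ m ⟧ + d * (+ 1 / 5) * ⟦ m ⟧ + d * (+ 1 / 4) * ⟦ m ⟧
      ≡⟨ solve 2 (λ d m → d :* con (+ 1 / 20) :* m :+ d :* con (+ 1 / 5) :* m :+ d :* con (+ 1 / 4) :* m
                          := d :* con (+ 1 / 2) :* m) refl d ⟦ m ⟧ ⟩
    d * (+ 1 / 2) * ⟦ m ⟧               ∎

  fine-partition-size : ∀ {β γ} k w D Δ → 0ℚ < β → 1 ℕ.≤ k → ⟦ Δ ⟧ ≤ γ * ⟦ k ⟧ →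
                    ⟦ w ⟧ * (β * ⟦ k ⟧) ≤ ⟦ 336 ℕ.* (k ℕ.∸ 1) ℕ.* (1 ℕ.+ Δ) ⟧ →
                    ⟦ D ⟧ * (β * ⟦ k ⟧) ≤ ⟦ 336 ℕ.* (k ℕ.∸ 1) ⟧ →
                    (⟦ w ⟧ + ⟦ D ⟧) * β ≤ (+ 336 / 1) * ((+ 2 / 1) + γ * ⟦ k ⟧)
  fine-partition-size {β} {γ} k w D Δ 0<β 1≤k Δ≤γk w≤ D≤ = ≤-cancel-*ʳ ⟦ k ⟧ (⟦⟧-mono-< {0} 1≤k) (begin
    (⟦ w ⟧ + ⟦ D ⟧) * β * ⟦ k ⟧
      ≡⟨ solve 4 (λ w D β k → (w :+ D) :* β :* k := w :* (β :* k) :+ D :* (β :* k)) refl ⟦ w ⟧ ⟦ D ⟧ β ⟦ k ⟧ ⟩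
    ⟦ w ⟧ * (β * ⟦ k ⟧) + ⟦ D ⟧ * (β * ⟦ k ⟧)
      ≤⟨ +-mono-≤ (≤-trans w≤ (⟦⟧-mono-≤ (ℕ.*-monoˡ-≤ (1 ℕ.+ Δ) k-1≤k)))
                  (≤-trans D≤ (⟦⟧-mono-≤ k-1≤k)) ⟩
    ⟦ 336 ℕ.* k ℕ.* (1 ℕ.+ Δ) ⟧ + ⟦ 336 ℕ.* k ⟧
      ≡⟨ cong₂ _+_ (trans (⟦⟧-homo-* (336 ℕ.* k) (1 ℕ.+ Δ)) (cong₂ _*_ (⟦⟧-homo-* 336 k) (⟦⟧-homo-+ 1 Δ)))
                   (⟦⟧-homo-* 336 k) ⟩
    (+ 336 / 1) * ⟦ k ⟧ * (1ℚ + ⟦ Δ ⟧) + (+ 336 / 1) * ⟦ k ⟧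
      ≤⟨ +-monoˡ-≤ ((+ 336 / 1) * ⟦ k ⟧) (≤-*ˡ ((+ 336 / 1) * ⟦ k ⟧) (0≤* {+ 336 / 1} (≤ᵇ⇒≤ _) (0≤⟦⟧ k)) (+-monoʳ-≤ 1ℚ Δ≤γk)) ⟩
    (+ 336 / 1) * ⟦ k ⟧ * (1ℚ + γ * ⟦ k ⟧) + (+ 336 / 1) * ⟦ k ⟧
      ≡⟨ solve 2 (λ k x → con (+ 336 / 1) :* k :* (con 1ℚ :+ x) :+ con (+ 336 / 1) :* k
                          := con (+ 336 / 1) :* (con (+ 2 / 1) :+ x) :* k) refl ⟦ k ⟧ (γ * ⟦ k ⟧) ⟩
    (+ 336 / 1) * ((+ 2 / 1) + γ * ⟦ k ⟧) * ⟦ k ⟧ ∎)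
    where
      k-1≤k : 336 ℕ.* (k ℕ.∸ 1) ℕ.≤ 336 ℕ.* k
      k-1≤k = ℕ.*-monoʳ-≤ 336 (ℕ.m∸n≤m k 1)

  bound-from-product : ∀ c M′ {k m} → suc (c ℕ.* suc M′) ℕ.≤ k → k ℕ.≤ m ℕ.* M′ → c ℕ.≤ m
  bound-from-product c M′ {k} {m} c[1+M′]<k k≤mM′ with c ℕ.≤? m
  ... | yes c≤m = c≤m
  ... | no  c≰m = ⊥-elim (ℕ.<-irrefl refl (ℕ.<-≤-trans (ℕ.≤-<-trans
          (ℕ.*-mono-≤ (ℕ.<⇒≤ (ℕ.≰⇒> c≰m)) (ℕ.n≤1+n M′)) c[1+M′]<k) k≤mM′))

  constant-term : ∀ {r} N m → 0ℚ < r → 1ℚ ≤ r * ⟦ N ⟧ → 5376 ℕ.* N ℕ.≤ m → + 2688 / 1 ≤ (+ 1 / 2) * (r * ⟦ m ⟧)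
  constant-term {r} N m 0<r 1≤rN 5376N≤m = begin
    + 2688 / 1                                 ≡⟨ *-identityʳ (+ 2688 / 1) ⟨
    (+ 2688 / 1) * 1ℚ                          ≤⟨ ≤-*ˡ (+ 2688 / 1) (≤ᵇ⇒≤ _) 1≤rN ⟩
    (+ 2688 / 1) * (r * ⟦ N ⟧)                 ≡⟨ solve 2 (λ r N → con (+ 2688 / 1) :* (r :* N)
                                                           := con (+ 1 / 2) :* (r :* (con (+ 5376 / 1) :* N))) refl r ⟦ N ⟧ ⟩
    (+ 1 / 2) * (r * ((+ 5376 / 1) * ⟦ N ⟧))   ≡⟨ cong (λ x → (+ 1 / 2) * (r * x)) (⟦⟧-homo-* 5376 N) ⟨
    (+ 1 / 2) * (r * ⟦ 5376 ℕ.* N ⟧)           ≤⟨ ≤-*ˡ (+ 1 / 2) (≤ᵇ⇒≤ _) (≤-*ˡ r (<⇒≤ 0<r) (⟦⟧-mono-≤ 5376N≤m)) ⟩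
    (+ 1 / 2) * (r * ⟦ m ⟧)                    ∎

  slope : ℕ → ℚ
  slope M′ = + 1 / (2688 ℕ.* suc M′)

  0<slope : ∀ M′ → 0ℚ < slope M′
  0<slope M′ = positive⁻¹ (slope M′) {{normalize-pos 1 (2688 ℕ.* suc M′)}}

  linear-term : ∀ {r} M′ k m → 0ℚ < r → k ℕ.≤ m ℕ.* M′ →
                (+ 1344 / 1) * (r * slope M′ * ⟦ k ⟧) ≤ (+ 1 / 2) * (r * ⟦ m ⟧)
  linear-term {r} M′ k m 0<r k≤mM′ = begin
    (+ 1344 / 1) * (r * g * ⟦ k ⟧)
      ≤⟨ ≤-*ˡ (+ 1344 / 1) (≤ᵇ⇒≤ _) (≤-*ˡ (r * g) (0≤* (<⇒≤ 0<r) (<⇒≤ 0<g))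
           (⟦⟧-mono-≤ (ℕ.≤-trans k≤mM′ (ℕ.*-monoʳ-≤ m (ℕ.n≤1+n M′))))) ⟩
    (+ 1344 / 1) * (r * g * ⟦ m ℕ.* suc M′ ⟧)
      ≡⟨ cong (λ x → (+ 1344 / 1) * (r * g * x)) (⟦⟧-homo-* m (suc M′)) ⟩
    (+ 1344 / 1) * (r * g * (⟦ m ⟧ * ⟦ suc M′ ⟧))
      ≡⟨ solve 4 (λ r g m s → con (+ 1344 / 1) :* (r :* g :* (m :* s))
                              := con (+ 1 / 2) :* (r :* m) :* (g :* (con (+ 2688 / 1) :* s))) refl r g ⟦ m ⟧ ⟦ suc M′ ⟧ ⟩
    (+ 1 / 2) * (r * ⟦ m ⟧) * (g * ((+ 2688 / 1) * ⟦ suc M′ ⟧))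
      ≡⟨ cong (λ x → (+ 1 / 2) * (r * ⟦ m ⟧) * x) (trans (cong (g *_) (sym (⟦⟧-homo-* 2688 (suc M′)))) g*2688[1+M′]≡1) ⟩
    (+ 1 / 2) * (r * ⟦ m ⟧) * 1ℚ
      ≡⟨ *-identityʳ _ ⟩
    (+ 1 / 2) * (r * ⟦ m ⟧) ∎
    where
      g = slope M′
      0<g = 0<slope M′
      g*2688[1+M′]≡1 : g * ⟦ 2688 ℕ.* suc M′ ⟧ ≡ 1ℚ
      g*2688[1+M′]≡1 = /-*-cancel 1 (M′ ℕ.+ 2687 ℕ.* suc M′)

  -- k₀ forces 5376 ≤ r m, and γ = r / (2688 (M′ + 1)) gives 1344 γ k ≤ r m / 2.
  constants : ∀ M′ r → 0ℚ < r → Σ ℕ λ k₀ → Σ ℚ λ γ → 0ℚ < γ × 1 ℕ.≤ k₀ ×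
              (∀ k m → k₀ ℕ.≤ k → k ℕ.≤ m ℕ.* M′ → (+ 1344 / 1) * ((+ 2 / 1) + γ * ⟦ k ⟧) ≤ r * ⟦ m ⟧)
  constants M′ r 0<r with archimedean r 0<r
  ... | N , 1≤rN = suc (5376 ℕ.* N ℕ.* suc M′) , r * slope M′ , 0<* 0<r (0<slope M′) , ℕ.s≤s ℕ.z≤n , bound
    where
      g = slope M′
      bound : ∀ k m → suc (5376 ℕ.* N ℕ.* suc M′) ℕ.≤ k → k ℕ.≤ m ℕ.* M′ →
              (+ 1344 / 1) * ((+ 2 / 1) + r * g * ⟦ k ⟧) ≤ r * ⟦ m ⟧
      bound k m k₀≤k k≤mM′ = begin
        (+ 1344 / 1) * ((+ 2 / 1) + r * g * ⟦ k ⟧)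
          ≡⟨ solve 1 (λ x → con (+ 1344 / 1) :* (con (+ 2 / 1) :+ x) := con (+ 2688 / 1) :+ con (+ 1344 / 1) :* x)
                     refl (r * g * ⟦ k ⟧) ⟩
        (+ 2688 / 1) + (+ 1344 / 1) * (r * g * ⟦ k ⟧)
          ≤⟨ +-mono-≤ (constant-term N m 0<r 1≤rN (bound-from-product (5376 ℕ.* N) M′ k₀≤k k≤mM′))
                      (linear-term M′ k m 0<r k≤mM′) ⟩
        (+ 1 / 2) * (r * ⟦ m ⟧) + (+ 1 / 2) * (r * ⟦ m ⟧)
          ≡⟨ solve 1 (λ x → con (+ 1 / 2) :* x :+ con (+ 1 / 2) :* x := x) refl (r * ⟦ m ⟧) ⟩
        r * ⟦ m ⟧ ∎

module EmbeddingIntoRegularPair where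

  open Counting
  open Rationals
  open Density
  open Estimates
  open import Defs hiding (sym)
  open import Data.Nat as ℕ using (ℕ; zero; suc)
  import Data.Nat.Properties as ℕ
  open import Data.Integer using (+_)
  open import Data.Rational using (ℚ; 0ℚ; 1ℚ; _/_; _≤_; _<_; _+_; _*_; _-_)
  open import Data.Rational.Properties
  import Data.Rational.Solver
  open import Data.Bool using (if_then_else_)
  open import Data.Maybe using (Maybe)
  open import Data.Product using (Σ; _,_; proj₁; proj₂)
  open import Data.Sum using (inj₁; inj₂)
  open import Relation.Binary.PropositionalEquality

  DomainEmbedding : ∀ {k p n} → Graph k → (Fin k → Maybe (Fin p)) → (Fin p → Bool) → Graph n → (v₁ v₂ U : VSet n) → Set
  DomainEmbedding {k} {p} {n} T part dd G v₁ v₂ U =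
    Σ ((v : Fin k) → inDom part dd v ≡ true → Fin n) λ φ →
      (∀ u v (pu : inDom part dd u ≡ true) (pv : inDom part dd v ≡ true) →
         φ u pu ≡ φ v pv → u ≡ v) ×
      (∀ v (pv : inDom part dd v ≡ true) → inW part v ≡ true →
         (v₁ (φ v pv) ≡ true × U (φ v pv) ≡ false)) ×
      (∀ v (pv : inDom part dd v ≡ true) → inW part v ≡ false →
         v₂ (φ v pv) ≡ true) ×
      (∀ u v (pu : inDom part dd u ≡ true) (pv : inDom part dd v ≡ true) →
         Adj T u v → Adj G (φ u pu) (φ v pv))

  Δ₂≤ : ∀ {k} (T : Graph k) col {q} → 0ℚ ≤ q → (∀ v → col v ≡ true → ⟦ deg T v ⟧ ≤ q) → ⟦ Δ₂ T col ⟧ ≤ q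
  Δ₂≤ T col 0≤q deg≤q with maxOver-attained col (deg T)
  ... | inj₁ Δ≡0          = subst (λ Δ → ⟦ Δ ⟧ ≤ _) (sym Δ≡0) 0≤q
  ... | inj₂ (v , V₂v , Δ≡) = subst (λ Δ → ⟦ Δ ⟧ ≤ _) (sym Δ≡) (deg≤q v V₂v)

  nonzero-factor : ∀ {k} m c → 1 ℕ.≤ k → k ℕ.≤ m ℕ.* c → 1 ℕ.≤ m
  nonzero-factor zero    c 1≤k k≤0 = ℕ.≤-trans 1≤k k≤0
  nonzero-factor (suc m) c _   _   = ℕ.s≤s ℕ.z≤n

  half-d*m≤m : ∀ {n} (G : Graph n) {d} v₁ v₂ m → d ≤ density G v₁ v₂ → d * (+ 1 / 2) * ⟦ m ⟧ ≤ ⟦ m ⟧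
  half-d*m≤m G {d} v₁ v₂ m d≤ = begin
    d * (+ 1 / 2) * ⟦ m ⟧   ≤⟨ ≤-*ʳ ⟦ m ⟧ (0≤⟦⟧ m) (fraction≤1 (+ 1 / 2) (≤ᵇ⇒≤ _) (≤ᵇ⇒≤ _) (≤-trans d≤ (density≤1 G v₁ v₂))) ⟩
    1ℚ * ⟦ m ⟧              ≡⟨ *-identityˡ ⟦ m ⟧ ⟩
    ⟦ m ⟧                   ∎
    where open ≤-Reasoning

  sides : ∀ {n} → VSet n → VSet n → Bool → VSet n
  sides v₁ v₂ b = if b then v₁ else v₂

  domain-bound : ∀ {k p} {T : Graph k} {col} {part : Fin k → Maybe (Fin p)} {dd} {β γ d : ℚ} m →
                 OneSidedFine T col part (β * ⟦ k ⟧) dd → 0ℚ < β → 1 ℕ.≤ k → ⟦ Δ₂ T col ⟧ ≤ γ * ⟦ k ⟧ →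
                 (+ 1344 / 1) * ((+ 2 / 1) + γ * ⟦ k ⟧) ≤ β * d * ⟦ m ⟧ →
                 ⟦ count (inDom part dd) ⟧ ≤ d * (+ 1 / 4) * ⟦ m ⟧
  domain-bound {k} {T = T} {col} {part} {dd} {β} {γ} {d} m fine 0<β 1≤k Δ≤γk large = ≤-cancel-*ʳ β 0<β (begin
    ⟦ count (inDom part dd) ⟧ * β
      ≤⟨ ≤-*ʳ β (<⇒≤ 0<β) (≤-trans (⟦⟧-mono-≤ (FinePartition.count-inDom part dd D''-single))
                                   (≤-reflexive (⟦⟧-homo-+ (count (inW part)) (count dd)))) ⟩
    (⟦ count (inW part) ⟧ + ⟦ count dd ⟧) * β
      ≤⟨ fine-partition-size {β} {γ} k (count (inW part)) (count dd) (Δ₂ T col) 0<β 1≤k Δ≤γk W-size D''-count ⟩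
    (+ 336 / 1) * ((+ 2 / 1) + γ * ⟦ k ⟧)
      ≡⟨ solve 1 (λ a → con (+ 336 / 1) :* a := con (+ 1 / 4) :* (con (+ 1344 / 1) :* a)) refl ((+ 2 / 1) + γ * ⟦ k ⟧) ⟩
    (+ 1 / 4) * ((+ 1344 / 1) * ((+ 2 / 1) + γ * ⟦ k ⟧))
      ≤⟨ ≤-*ˡ (+ 1 / 4) (≤ᵇ⇒≤ _) large ⟩
    (+ 1 / 4) * (β * d * ⟦ m ⟧)
      ≡⟨ solve 3 (λ β d m → con (+ 1 / 4) :* (β :* d :* m) := d :* con (+ 1 / 4) :* m :* β) refl β d ⟦ m ⟧ ⟩
    d * (+ 1 / 4) * ⟦ m ⟧ * β ∎)
    where
      open OneSidedFine fine
      open ≤-Reasoning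
      open Data.Rational.Solver.+-*-Solver using (solve; _:*_; _:=_; con)

  pair-room : ∀ {n} (G : Graph n) {ε d} (v₁ v₂ U : VSet n) D →
              RegularPair G ε v₁ v₂ → d ≤ density G v₁ v₂ → 0ℚ < d → 0ℚ < ε → ε ≤ d * d * (+ 1 / 100) →
              count v₁ ≡ count v₂ → 1 ℕ.≤ count v₁ →
              ⟦ count U ℕ.* count U ⟧ ≤ (+ 4 / 1) * ε * ⟦ count v₁ ℕ.* count v₁ ⟧ →
              ⟦ D ⟧ ≤ d * (+ 1 / 4) * ⟦ count v₁ ⟧ →
              ∀ b → ⟦ count (atypical G (d * (+ 1 / 2) * ⟦ count v₁ ⟧) (sides v₁ v₂ b) (sides v₁ v₂ (not b))) ℕ.+ count U ℕ.+ D ⟧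
                    ≤ d * (+ 1 / 2) * ⟦ count v₁ ⟧
  pair-room G {ε} {d} v₁ v₂ U D reg d≤ 0<d 0<ε ε≤d²/100 |v₁|≡|v₂| 1≤|v₁| |U|²≤ D≤ b =
    room-bound {d} {ε} (count v₁) (count (atypical G t (sides v₁ v₂ b) (sides v₁ v₂ (not b)))) (count U) D ε≤d/20′ (<⇒≤ (few b))
               (U-bound {d} {ε} (count U) (count v₁) (<⇒≤ 0<d) ε≤d²/100 |U|²≤) D≤
    where
      t = d * (+ 1 / 2) * ⟦ count v₁ ⟧
      d≤1 : d ≤ 1ℚ
      d≤1 = ≤-trans d≤ (density≤1 G v₁ v₂)
      ε≤d/20′ : ε ≤ d * (+ 1 / 20)
      ε≤d/20′ = ε≤d/20 (<⇒≤ 0<d) d≤1 ε≤d²/100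
      ε≤1 : ε ≤ 1ℚ
      ε≤1 = ≤-trans ε≤d/20′ (fraction≤1 (+ 1 / 20) (≤ᵇ⇒≤ _) (≤ᵇ⇒≤ _) d≤1)
      τ≤d-ε : d * (+ 1 / 2) ≤ d - ε
      τ≤d-ε = half≤d-ε (<⇒≤ 0<d) ε≤d/20′
      1≤|v₂| : 1 ℕ.≤ count v₂
      1≤|v₂| = subst (1 ℕ.≤_) |v₁|≡|v₂| 1≤|v₁|
      few : ∀ b → ⟦ count (atypical G t (sides v₁ v₂ b) (sides v₁ v₂ (not b))) ⟧ < ε * ⟦ count v₁ ⟧
      few true  = subst (λ c → ⟦ count (atypical G (d * (+ 1 / 2) * ⟦ c ⟧) v₁ v₂) ⟧ < ε * ⟦ count v₁ ⟧) (sym |v₁|≡|v₂|)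
                        (few-atypical G v₁ v₂ reg d≤ 0<ε ε≤1 τ≤d-ε 1≤|v₁| 1≤|v₂|)
      few false = subst (λ c → ⟦ count (atypical G t v₂ v₁) ⟧ < ε * ⟦ c ⟧) (sym |v₁|≡|v₂|)
                        (few-atypical G v₂ v₁ (regular-sym G v₁ v₂ reg) (subst (d ≤_) (density-sym G v₁ v₂) d≤)
                                      0<ε ε≤1 τ≤d-ε 1≤|v₂| 1≤|v₁|)

  embed-fine-partition : ∀ {k p n} {T : Graph k} {col} {part : Fin k → Maybe (Fin p)} {dd ℓ} →
    ¬ Cycle T → ProperColouring T col → OneSidedFine T col part ℓ dd →
    ∀ (G : Graph n) (v₁ v₂ U : VSet n) t → count v₁ ≡ count v₂ → 1 ℕ.≤ count v₁ → t ≤ ⟦ count v₁ ⟧ →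
    (∀ b → ⟦ count (atypical G t (sides v₁ v₂ b) (sides v₁ v₂ (not b))) ℕ.+ count U ℕ.+ count (inDom part dd) ⟧ ≤ t) →
    DomainEmbedding T part dd G v₁ v₂ U
  embed-fine-partition {T = T} {col} {part} {dd} acyclic proper fine G v₁ v₂ U t |v₁|≡|v₂| 1≤m t≤m room =
    (λ v _ → φ v) , injective , on-W , off-W , homomorphic
    where
      open OneSidedFine fine
      size : ∀ b → count (sides v₁ v₂ b) ≡ count v₁
      size true  = refl
      size false = sym |v₁|≡|v₂|
      open PairEmbedding T acyclic (inDom part dd) (inW part)
             (FinePartition.alternating part dd T col proper W⊆V₁ D''-single K-nbhd)
             G (sides v₁ v₂) U t (count v₁) size 1≤m t≤m room
      φ = proj₁ embedding
      open Embeds (proj₂ embedding)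
      on-W : ∀ v (pv : inDom part dd v ≡ true) → inW part v ≡ true → v₁ (φ v) ≡ true × U (φ v) ≡ false
      on-W v pv v∈W = let in-side , _ , ∉U = admissible v pv
                      in subst (λ b → sides v₁ v₂ b (φ v) ≡ true) v∈W in-side , ∉U
      off-W : ∀ v (pv : inDom part dd v ≡ true) → inW part v ≡ false → v₂ (φ v) ≡ true
      off-W v pv v∉W = subst (λ b → sides v₁ v₂ b (φ v) ≡ true) v∉W (proj₁ (admissible v pv))

open import Defs
open import Data.Nat using (ℕ; _≥_)
open import Data.Rational using (ℚ; 0ℚ; _<_; _≤_; _*_; _/_)
open import Data.Integer using (+_)
open import Data.Bool using (Bool; true; false; _∨_)
open import Data.Fin using (Fin)
open import Data.Maybe using (Maybe)
open import Data.Product using (Σ; ∃; _×_)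
open import Relation.Binary.PropositionalEquality using (_≡_)
open import Data.Product using (_,_)
open import Data.Rational.Properties using (<⇒≤)
open Rationals using (0<*; 0≤*; 0≤⟦⟧)
open Estimates using (constants)
import Data.Nat.Properties
open EmbeddingIntoRegularPair

proposition3p6 :
  (M : ℚ → ℕ) (d β ε : ℚ) → 0ℚ < d → 0ℚ < β → 0ℚ < ε →
  ε ≤ (d * d) * (+ 1 / 100) →
  Σ ℕ λ k₀ → Σ ℚ λ γ → 0ℚ < γ ×
    (∀ (k : ℕ) → k ≥ k₀ →
     ∀ (T : Graph k) → IsTree T →
     ∀ (col : Fin k → Bool) → ProperColouring T col →
     (∀ v → col v ≡ true → ⟦ deg T v ⟧ ≤ γ * ⟦ k ⟧) →
     ∀ (p : ℕ) (part : Fin k → Maybe (Fin p)) (dd : Fin p → Bool) →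
     OneSidedFine T col part (β * ⟦ k ⟧) dd →
     ∀ (n : ℕ) (G : Graph n) (v₁ v₂ U : VSet n) →
     Disjoint v₁ v₂ →
     RegularPair G ε v₁ v₂ →
     d ≤ density G v₁ v₂ →
     count v₁ ≡ count v₂ →
     k Data.Nat.≤ count v₁ Data.Nat.* M ε →
     U ⊆ v₁ →
     ⟦ count U Data.Nat.* count U ⟧ ≤ (+ 4 / 1) * ε * ⟦ count v₁ Data.Nat.* count v₁ ⟧ →
     Σ ((v : Fin k) → inDom part dd v ≡ true → Fin n) λ φ →
       (∀ u v (pu : inDom part dd u ≡ true) (pv : inDom part dd v ≡ true) →
          φ u pu ≡ φ v pv → u ≡ v) ×
       (∀ v (pv : inDom part dd v ≡ true) → inW part v ≡ true →
          (v₁ (φ v pv) ≡ true × U (φ v pv) ≡ false)) ×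
       (∀ v (pv : inDom part dd v ≡ true) → inW part v ≡ false →
          v₂ (φ v pv) ≡ true) ×
       (∀ u v (pu : inDom part dd u ≡ true) (pv : inDom part dd v ≡ true) →
          Adj T u v → Adj G (φ u pu) (φ v pv)))
proposition3p6 M d β ε 0<d 0<β 0<ε ε≤d²/100 =
  let k₀ , γ , 0<γ , 1≤k₀ , large = constants (M ε) (β * d) (0<* 0<β 0<d)
  in k₀ , γ , 0<γ ,
     λ k k₀≤k T (_ , acyclic) col proper deg≤γk p part dd fine n G v₁ v₂ U _ reg d≤ |v₁|≡|v₂| k≤mM _ |U|²≤ →
       let m = count v₁
           1≤k = Data.Nat.Properties.≤-trans 1≤k₀ k₀≤k
           1≤m = nonzero-factor m (M ε) 1≤k k≤mM
           Δ≤γk = Δ₂≤ T col (0≤* (<⇒≤ 0<γ) (0≤⟦⟧ k)) deg≤γk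
           Dom≤ = domain-bound {γ = γ} {d = d} m fine 0<β 1≤k Δ≤γk (large k m k₀≤k k≤mM)
       in embed-fine-partition acyclic proper fine G v₁ v₂ U (d * (+ 1 / 2) * ⟦ m ⟧) |v₁|≡|v₂| 1≤m
            (half-d*m≤m G v₁ v₂ m d≤)
            (pair-room G v₁ v₂ U (count (inDom part dd)) reg d≤ 0<d 0<ε ε≤d²/100 |v₁|≡|v₂| 1≤m |U|²≤ Dom≤)
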